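{- For every integer $a\geq 1$, \[ R_3\bigl(ax+y=z\bigr) = a^3+5a^2+7a+1 . \]
   Context: For a linear equation $\mathcal{E}$ in the unknowns $x,y,z$ and a positive integer $k$, the $k$-colour Rado number $R_k(\mathcal{E})$ is the smallest positive integer $n$, if it exists, such that every colouring of $\{1,2,\dots,n\}$ with $k$ colours contains a monochromatic solution to $\mathcal{E}$, i.e. a solution $(x,y,z)$ with $x,y,z\in\{1,\dots,n\}$ (not necessarily distinct) all of the same colour; $R_k(\mathcal{E})=\infty$ if no such $n$ exists. In the paper's notation the equation $ax+y=z$ is written $\mathcal{E}(3,0;a,1,1)$. -}

module Defs where

open import Data.Nat using (ℕ; _+_; _*_; _^_; _≤_; _<_)
open import Data.Fin using (Fin)
open import Data.Product using (Σ; _×_; ∃-syntax)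
open import Relation.Binary.PropositionalEquality using (_≡_)
open import Relation.Nullary using (¬_)

-- A k-colouring of {1,…,n}: a map ℕ → Fin k (only values on 1..n are relevant).
Colouring : ℕ → Set
Colouring k = ℕ → Fin k

-- χ has a monochromatic solution of a·x + y = z within {1,…,n}
-- (x, y, z not necessarily distinct).
HasMonoSol : (a n : ℕ) {k : ℕ} → Colouring k → Set
HasMonoSol a n χ =
  ∃[ x ] ∃[ y ] ∃[ z ]
    (1 ≤ x × x ≤ n × 1 ≤ y × y ≤ n × 1 ≤ z × z ≤ n ×
     a * x + y ≡ z × χ x ≡ χ y × χ y ≡ χ z)

RadoProp : (k a n : ℕ) → Set
RadoProp k a n = (χ : Colouring k) → HasMonoSol a n χ

IsRadoNumber : (k a n : ℕ) → Set
IsRadoNumber k a n =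
  1 ≤ n × RadoProp k a n × (∀ m → 1 ≤ m → m < n → ¬ RadoProp k a m)

-- Write a = 1 + b. Every point used in the upper bound is a polynomial in b with natural
-- coefficients, and a coefficientwise inequality between such polynomials holds for every b.
-- Hence one finite decision tree proves the upper bound for all a at once: after fixing the
-- colour of a + 1 by symmetry, it branches on the colours of further points p with
-- 1 ≤ p ≤ a³ + 5a² + 7a + 1 coefficientwise, and closes every branch with equally coloured
-- x, y, z such that (1 + b)x + y = z is a polynomial identity.
-- For the lower bound, colour the blocks ending at a, a² + 2a, a² + 3a, a³ + 4a² + 4a,
-- a³ + 4a² + 5a, a³ + 5a² + 6a and a³ + 5a² + 7a with colours 0, 1, 0, 2, 0, 1, 0. For any three
-- equally coloured blocks X, Y, Z, the interval a·X + Y lies entirely below or entirely above Z.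

{-# OPTIONS --safe #-}
module Submission where

open import Defs
open import Data.Empty using (⊥-elim)
open import Data.Fin using (Fin; zero; suc; _≟_; #_)
open import Data.Fin.Patterns using (0F; 1F; 2F)
import Data.Fin.Permutation.Components as PC
open import Data.Fin.Properties using (all?)
open import Data.List using (List; []; _∷_; [_]; map)
open import Data.List.Membership.Propositional using (_∈_)
open import Data.List.Relation.Unary.All as All using ()
open import Data.List.Relation.Unary.Any using (here; there)
open import Data.Nat using (ℕ; suc; _+_; _*_; _^_; _≤_; _<_; _≤?_; _<?_; z≤n)
open import Data.Nat.Properties
  using (+-identityʳ; *-zeroʳ; *-identityʳ; +-comm; +-mono-≤; *-monoʳ-≤; +-mono-≤-<;
         ≤-antisym; ≤-trans; ≤-pred; <⇒≱; ≰⇒>; m≤n+m; module ≤-Reasoning)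
open import Data.Nat.Solver using (module +-*-Solver)
open import Data.Nat.Tactic.RingSolver using (solve-∀)
open import Data.Product using (_×_; _,_; ∃-syntax)
open import Data.Sum using (_⊎_; inj₁; inj₂)
open import Data.Unit using (⊤; tt)
open import Data.Vec as Vec using (Vec; []; _∷_)
open import Data.Vec.Relation.Unary.All as VecAll using ([]; _∷_)
open import Data.Vec.Relation.Unary.All.Properties using (lookup⁺)
open import Function using (_∘_)
open import Function.Definitions using (Injective)
open import Relation.Binary.PropositionalEquality
  using (_≡_; _≢_; refl; sym; trans; cong; cong₂; subst; subst₂; module ≡-Reasoning)
open import Relation.Nullary using (¬_; Dec; yes; no)
open import Relation.Nullary.Decidable using (True; from-yes; dec-true; _×-dec_; _⊎-dec_; _→-dec_)

Poly : Set
Poly = List ℕ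

⟦_⟧ : Poly → ℕ → ℕ
⟦ [] ⟧    x = 0
⟦ c ∷ p ⟧ x = c + x * ⟦ p ⟧ x

infixl 6 _+ᴾ_
infixl 7 _*ᴾ_ _·ᴾ_
infix 4 _≤ᶜ_ _≤ᶜ?_

_+ᴾ_ : Poly → Poly → Poly
[]      +ᴾ q       = q
(c ∷ p) +ᴾ []      = c ∷ p
(c ∷ p) +ᴾ (d ∷ q) = c + d ∷ p +ᴾ q

_·ᴾ_ : ℕ → Poly → Poly
c ·ᴾ q = map (c *_) q

_*ᴾ_ : Poly → Poly → Poly
[]      *ᴾ q = []
(c ∷ p) *ᴾ q = c ·ᴾ q +ᴾ (0 ∷ p *ᴾ q)

⟦+ᴾ⟧ : ∀ p q x → ⟦ p +ᴾ q ⟧ x ≡ ⟦ p ⟧ x + ⟦ q ⟧ x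
⟦+ᴾ⟧ []      q       x = refl
⟦+ᴾ⟧ (c ∷ p) []      x = sym (+-identityʳ _)
⟦+ᴾ⟧ (c ∷ p) (d ∷ q) x = begin
  c + d + x * ⟦ p +ᴾ q ⟧ x            ≡⟨ cong (λ v → c + d + x * v) (⟦+ᴾ⟧ p q x) ⟩
  c + d + x * (⟦ p ⟧ x + ⟦ q ⟧ x)     ≡⟨ interchange c d x (⟦ p ⟧ x) (⟦ q ⟧ x) ⟩
  c + x * ⟦ p ⟧ x + (d + x * ⟦ q ⟧ x) ∎
  where
  open ≡-Reasoning
  interchange : ∀ c d x u v → c + d + x * (u + v) ≡ c + x * u + (d + x * v)
  interchange = solve-∀

⟦·ᴾ⟧ : ∀ c q x → ⟦ c ·ᴾ q ⟧ x ≡ c * ⟦ q ⟧ x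
⟦·ᴾ⟧ c []      x = sym (*-zeroʳ c)
⟦·ᴾ⟧ c (d ∷ q) x = begin
  c * d + x * ⟦ c ·ᴾ q ⟧ x       ≡⟨ cong (λ v → c * d + x * v) (⟦·ᴾ⟧ c q x) ⟩
  c * d + x * (c * ⟦ q ⟧ x)      ≡⟨ factor c d x (⟦ q ⟧ x) ⟩
  c * (d + x * ⟦ q ⟧ x)          ∎
  where
  open ≡-Reasoning
  factor : ∀ c d x u → c * d + x * (c * u) ≡ c * (d + x * u)
  factor = solve-∀

⟦*ᴾ⟧ : ∀ p q x → ⟦ p *ᴾ q ⟧ x ≡ ⟦ p ⟧ x * ⟦ q ⟧ x
⟦*ᴾ⟧ []      q x = refl
⟦*ᴾ⟧ (c ∷ p) q x = begin
  ⟦ c ·ᴾ q +ᴾ (0 ∷ p *ᴾ q) ⟧ x            ≡⟨ ⟦+ᴾ⟧ (c ·ᴾ q) (0 ∷ p *ᴾ q) x ⟩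
  ⟦ c ·ᴾ q ⟧ x + x * ⟦ p *ᴾ q ⟧ x          ≡⟨ cong₂ (λ u v → u + x * v) (⟦·ᴾ⟧ c q x) (⟦*ᴾ⟧ p q x) ⟩
  c * ⟦ q ⟧ x + x * (⟦ p ⟧ x * ⟦ q ⟧ x)    ≡⟨ factor c x (⟦ p ⟧ x) (⟦ q ⟧ x) ⟩
  (c + x * ⟦ p ⟧ x) * ⟦ q ⟧ x              ∎
  where
  open ≡-Reasoning
  factor : ∀ c x u v → c * v + x * (u * v) ≡ (c + x * u) * v
  factor = solve-∀

_≤ᶜ_ : Poly → Poly → Set
[]      ≤ᶜ q       = ⊤
(c ∷ p) ≤ᶜ []      = c ≤ 0 × p ≤ᶜ []
(c ∷ p) ≤ᶜ (d ∷ q) = c ≤ d × p ≤ᶜ q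

_≤ᶜ?_ : (p q : Poly) → Dec (p ≤ᶜ q)
[]      ≤ᶜ? q       = yes tt
(c ∷ p) ≤ᶜ? []      = c ≤? 0 ×-dec p ≤ᶜ? []
(c ∷ p) ≤ᶜ? (d ∷ q) = c ≤? d ×-dec p ≤ᶜ? q

≤ᶜ⇒≤ : ∀ {p q} x → p ≤ᶜ q → ⟦ p ⟧ x ≤ ⟦ q ⟧ x
≤ᶜ⇒≤ {[]}    {q}     x _ = z≤n
≤ᶜ⇒≤ {c ∷ p} {[]}    x (c≤0 , p≤0) = begin
  c + x * ⟦ p ⟧ x ≤⟨ +-mono-≤ c≤0 (*-monoʳ-≤ x (≤ᶜ⇒≤ x p≤0)) ⟩
  0 + x * 0       ≡⟨ *-zeroʳ x ⟩
  0               ∎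
  where open ≤-Reasoning
≤ᶜ⇒≤ {c ∷ p} {d ∷ q} x (c≤d , p≤q) = +-mono-≤ c≤d (*-monoʳ-≤ x (≤ᶜ⇒≤ x p≤q))

⟦[_]⟧ : ∀ c x → ⟦ [ c ] ⟧ x ≡ c
⟦[ c ]⟧ x = trans (cong (c +_) (*-zeroʳ x)) (+-identityʳ c)

⟦*ᴾ+ᴾ⟧ : ∀ a p q x → ⟦ a *ᴾ p +ᴾ q ⟧ x ≡ ⟦ a ⟧ x * ⟦ p ⟧ x + ⟦ q ⟧ x
⟦*ᴾ+ᴾ⟧ a p q x = trans (⟦+ᴾ⟧ (a *ᴾ p) q x) (cong (_+ ⟦ q ⟧ x) (⟦*ᴾ⟧ a p x))

⟦+ᴾ1⟧ : ∀ p x → ⟦ p +ᴾ [ 1 ] ⟧ x ≡ suc (⟦ p ⟧ x)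
⟦+ᴾ1⟧ p x = trans (⟦+ᴾ⟧ p [ 1 ] x) (trans (cong (⟦ p ⟧ x +_) (⟦[ 1 ]⟧ x)) (+-comm (⟦ p ⟧ x) 1))

⟦c∷1⟧ : ∀ c x → ⟦ c ∷ 1 ∷ [] ⟧ x ≡ c + x
⟦c∷1⟧ c x = cong (c +_) (trans (cong (λ v → x * suc v) (*-zeroʳ x)) (*-identityʳ x))

hasMonoSol-∘⁻ : ∀ {k l a n} {χ : Colouring k} {f : Fin k → Fin l} →
                Injective _≡_ _≡_ f → HasMonoSol a n (f ∘ χ) → HasMonoSol a n χ
hasMonoSol-∘⁻ f-inj (x , y , z , lx , ux , ly , uy , lz , uz , sol , fx≡fy , fy≡fz) =
  x , y , z , lx , ux , ly , uy , lz , uz , sol , f-inj fx≡fy , f-inj fy≡fz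

transpose-matchˡ : ∀ {n} (i j : Fin n) → PC.transpose i j i ≡ j
transpose-matchˡ i j rewrite dec-true (i ≟ i) refl = refl

transpose-injective : ∀ {n} (i j : Fin n) → Injective _≡_ _≡_ (PC.transpose i j)
transpose-injective i j {c} {d} eq = begin
  c                                     ≡⟨ PC.transpose-inverse j i ⟨
  PC.transpose j i (PC.transpose i j c) ≡⟨ cong (PC.transpose j i) eq ⟩
  PC.transpose j i (PC.transpose i j d) ≡⟨ PC.transpose-inverse j i ⟩
  d                                     ∎
  where open ≡-Reasoning

-- A certificate refers to the points coloured so far by position, 0 being the most recent one.
data Certificate (k : ℕ) : ℕ → Set where
  monoSol : ∀ {n} (x y z : Fin n) → Certificate k n
  branch  : ∀ {n} → Poly → (Fin k → Certificate k (suc n)) → Certificate k n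

module Refutation (A N : Poly) where

  InRange : Poly → Set
  InRange p = [ 1 ] ≤ᶜ p × p ≤ᶜ N

  Solves : Poly → Poly → Poly → Set
  Solves x y z = A *ᴾ x +ᴾ y ≤ᶜ z × z ≤ᶜ A *ᴾ x +ᴾ y

  MonoSolution : ∀ {k} → Poly × Fin k → Poly × Fin k → Poly × Fin k → Set
  MonoSolution (x , c) (y , d) (z , e) = c ≡ d × d ≡ e × Solves x y z

  Valid : ∀ {k n} → Vec (Poly × Fin k) n → Certificate k n → Set
  Valid Γ (monoSol i j l) = MonoSolution (Vec.lookup Γ i) (Vec.lookup Γ j) (Vec.lookup Γ l)
  Valid Γ (branch p ts) = InRange p × (∀ c → Valid ((p , c) ∷ Γ) (ts c))

  inRange? : ∀ p → Dec (InRange p)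
  inRange? p = [ 1 ] ≤ᶜ? p ×-dec p ≤ᶜ? N

  monoSolution? : ∀ {k} (u v w : Poly × Fin k) → Dec (MonoSolution u v w)
  monoSolution? (x , c) (y , d) (z , e) =
    c ≟ d ×-dec d ≟ e ×-dec (A *ᴾ x +ᴾ y ≤ᶜ? z ×-dec z ≤ᶜ? A *ᴾ x +ᴾ y)

  valid? : ∀ {k n} (Γ : Vec (Poly × Fin k) n) t → Dec (Valid Γ t)
  valid? Γ (monoSol i j l) = monoSolution? (Vec.lookup Γ i) (Vec.lookup Γ j) (Vec.lookup Γ l)
  valid? Γ (branch p ts) = inRange? p ×-dec all? (λ c → valid? ((p , c) ∷ Γ) (ts c))

  Colours : ∀ {k} → ℕ → Colouring k → Poly × Fin k → Set
  Colours b χ (p , c) = (1 ≤ ⟦ p ⟧ b × ⟦ p ⟧ b ≤ ⟦ N ⟧ b) × χ (⟦ p ⟧ b) ≡ c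

  inRange-sound : ∀ {p} b → InRange p → 1 ≤ ⟦ p ⟧ b × ⟦ p ⟧ b ≤ ⟦ N ⟧ b
  inRange-sound {p} b (1≤p , p≤N) = subst (_≤ ⟦ p ⟧ b) (⟦[ 1 ]⟧ b) (≤ᶜ⇒≤ b 1≤p) , ≤ᶜ⇒≤ b p≤N

  solves-sound : ∀ {x y z} b → Solves x y z → ⟦ A ⟧ b * ⟦ x ⟧ b + ⟦ y ⟧ b ≡ ⟦ z ⟧ b
  solves-sound {x} {y} {z} b (≤z , z≤) = begin
    ⟦ A ⟧ b * ⟦ x ⟧ b + ⟦ y ⟧ b ≡⟨ ⟦*ᴾ+ᴾ⟧ A x y b ⟨
    ⟦ A *ᴾ x +ᴾ y ⟧ b           ≡⟨ ≤-antisym (≤ᶜ⇒≤ b ≤z) (≤ᶜ⇒≤ b z≤) ⟩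
    ⟦ z ⟧ b                     ∎
    where open ≡-Reasoning

  valid-sound : ∀ {k n} b (χ : Colouring k) (Γ : Vec (Poly × Fin k) n) t →
                Valid Γ t → VecAll.All (Colours b χ) Γ → HasMonoSol (⟦ A ⟧ b) (⟦ N ⟧ b) χ
  valid-sound b χ Γ (monoSol i j l) (c≡d , d≡e , sol) cols
    with lookup⁺ cols i | lookup⁺ cols j | lookup⁺ cols l
  ... | (1≤x , x≤N) , χx | (1≤y , y≤N) , χy | (1≤z , z≤N) , χz =
    _ , _ , _ , 1≤x , x≤N , 1≤y , y≤N , 1≤z , z≤N , solves-sound b sol ,
    trans χx (trans c≡d (sym χy)) , trans χy (trans d≡e (sym χz))
  valid-sound b χ Γ (branch p ts) (p∈N , children) cols =
    valid-sound b χ _ (ts (χ (⟦ p ⟧ b))) (children _) ((inRange-sound b p∈N , refl) ∷ cols)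

  valid⇒rado : ∀ {k} p (t : Certificate (suc k) 1) → InRange p → Valid ((p , zero) ∷ []) t →
               ∀ b → RadoProp (suc k) (⟦ A ⟧ b) (⟦ N ⟧ b)
  valid⇒rado {k} p t p∈N valid b χ =
    hasMonoSol-∘⁻ {a = ⟦ A ⟧ b} (transpose-injective c zero)
      (valid-sound b (σ ∘ χ) _ t valid ((inRange-sound b p∈N , transpose-matchˡ c zero) ∷ []))
    where
    c : Fin (suc k)
    c = χ (⟦ p ⟧ b)
    σ : Fin (suc k) → Fin (suc k)
    σ = PC.transpose c zero

Block : ℕ → Set
Block k = Poly × Poly × Fin k

colour : ∀ {k} → Block k → Fin k
colour (_ , _ , c) = c

InBlock : ∀ {k} → ℕ → Block k → ℕ → Set
InBlock x (p , q , _) i = ⟦ p ⟧ x < i × i ≤ ⟦ q ⟧ x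

blocks : ∀ {k} → Poly → List (Poly × Fin k) → List (Block k)
blocks p []            = []
blocks p ((q , c) ∷ L) = (p , q , c) ∷ blocks q L

lastTop : ∀ {k} → Poly → List (Poly × Fin k) → Poly
lastTop p []            = p
lastTop p ((q , _) ∷ L) = lastTop q L

blockColouring : ∀ {k} → List (Poly × Fin (suc k)) → ℕ → Colouring (suc k)
blockColouring []            x i = zero
blockColouring ((q , c) ∷ L) x i with i ≤? ⟦ q ⟧ x
... | yes _ = c
... | no  _ = blockColouring L x i

block-cover : ∀ {k} (L : List (Poly × Fin (suc k))) p x i → ⟦ p ⟧ x < i → i ≤ ⟦ lastTop p L ⟧ x →
              ∃[ B ] B ∈ blocks p L × InBlock x B i × blockColouring L x i ≡ colour B
block-cover []            p x i p<i i≤p = ⊥-elim (<⇒≱ p<i i≤p)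
block-cover ((q , c) ∷ L) p x i p<i i≤top with i ≤? ⟦ q ⟧ x
... | yes i≤q = (p , q , c) , here refl , (p<i , i≤q) , refl
... | no  i≰q =
  let B , B∈ , i∈B , colour≡ = block-cover L q x i (≰⇒> i≰q) i≤top
  in B , there B∈ , i∈B , colour≡

module SumFreeBlocks (A : Poly) where

  Apart : ∀ {k} → Block k → Block k → Block k → Set
  Apart (px , qx , _) (py , qy , _) (pz , qz , _) =
    A *ᴾ qx +ᴾ qy ≤ᶜ pz ⊎ qz ≤ᶜ A *ᴾ (px +ᴾ [ 1 ]) +ᴾ py

  apart? : ∀ {k} (X Y Z : Block k) → Dec (Apart X Y Z)
  apart? (px , qx , _) (py , qy , _) (pz , qz , _) =
    A *ᴾ qx +ᴾ qy ≤ᶜ? pz ⊎-dec qz ≤ᶜ? A *ᴾ (px +ᴾ [ 1 ]) +ᴾ py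

  SumFree : ∀ {k} → List (Poly × Fin k) → Set
  SumFree L = All.All (λ X → All.All (λ Y → All.All (λ Z →
    colour X ≡ colour Y → colour Y ≡ colour Z → Apart X Y Z) Bs) Bs) Bs
    where Bs = blocks [] L

  sumFree? : ∀ {k} (L : List (Poly × Fin k)) → Dec (SumFree L)
  sumFree? L = All.all? (λ X → All.all? (λ Y → All.all? (λ Z →
    colour X ≟ colour Y →-dec colour Y ≟ colour Z →-dec apart? X Y Z) Bs) Bs) Bs
    where Bs = blocks [] L

  apart-sound : ∀ {k} {X Y Z : Block k} {x i j l} → Apart X Y Z →
                InBlock x X i → InBlock x Y j → InBlock x Z l → ⟦ A ⟧ x * i + j ≢ l
  apart-sound {X = px , qx , _} {py , qy , _} {pz , qz , _} {x} {i} {j} {l}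
              (inj₁ top≤pz) (_ , i≤qx) (_ , j≤qy) (pz<l , _) refl =
    <⇒≱ pz<l (begin
      ⟦ A ⟧ x * i + j               ≤⟨ +-mono-≤ (*-monoʳ-≤ (⟦ A ⟧ x) i≤qx) j≤qy ⟩
      ⟦ A ⟧ x * ⟦ qx ⟧ x + ⟦ qy ⟧ x ≡⟨ ⟦*ᴾ+ᴾ⟧ A qx qy x ⟨
      ⟦ A *ᴾ qx +ᴾ qy ⟧ x           ≤⟨ ≤ᶜ⇒≤ x top≤pz ⟩
      ⟦ pz ⟧ x                      ∎)
    where open ≤-Reasoning
  apart-sound {X = px , qx , _} {py , qy , _} {pz , qz , _} {x} {i} {j} {l}
              (inj₂ qz≤bottom) (px<i , _) (py<j , _) (_ , l≤qz) refl =
    <⇒≱ (begin-strict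
      ⟦ A *ᴾ (px +ᴾ [ 1 ]) +ᴾ py ⟧ x          ≡⟨ ⟦*ᴾ+ᴾ⟧ A (px +ᴾ [ 1 ]) py x ⟩
      ⟦ A ⟧ x * ⟦ px +ᴾ [ 1 ] ⟧ x + ⟦ py ⟧ x ≡⟨ cong (λ v → ⟦ A ⟧ x * v + ⟦ py ⟧ x) (⟦+ᴾ1⟧ px x) ⟩
      ⟦ A ⟧ x * suc (⟦ px ⟧ x) + ⟦ py ⟧ x    <⟨ +-mono-≤-< (*-monoʳ-≤ (⟦ A ⟧ x) px<i) py<j ⟩
      ⟦ A ⟧ x * i + j                         ∎)
      (≤-trans l≤qz (≤ᶜ⇒≤ x qz≤bottom))
    where open ≤-Reasoning

  sumFree⇒noMonoSol : ∀ {k} (L : List (Poly × Fin (suc k))) → SumFree L → ∀ x m →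
                      m ≤ ⟦ lastTop [] L ⟧ x → ¬ HasMonoSol (⟦ A ⟧ x) m (blockColouring L x)
  sumFree⇒noMonoSol L sf x m m≤top
                    (i , j , l , 1≤i , i≤m , 1≤j , j≤m , 1≤l , l≤m , sol , χi≡χj , χj≡χl) =
    let X , X∈ , i∈X , χi = cover i 1≤i i≤m
        Y , Y∈ , j∈Y , χj = cover j 1≤j j≤m
        Z , Z∈ , l∈Z , χl = cover l 1≤l l≤m
        apart = All.lookup (All.lookup (All.lookup sf X∈) Y∈) Z∈
                  (trans (sym χi) (trans χi≡χj χj))
                  (trans (sym χj) (trans χj≡χl χl))
    in apart-sound {X = X} {Y} {Z} apart i∈X j∈Y l∈Z sol
    where
    cover : ∀ i → 1 ≤ i → i ≤ m →
            ∃[ B ] B ∈ blocks [] L × InBlock x B i × blockColouring L x i ≡ colour B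
    cover i 1≤i i≤m = block-cover L [] x i 1≤i (≤-trans i≤m m≤top)

radoNumber : ℕ → ℕ
radoNumber a = a ^ 3 + 5 * a ^ 2 + 7 * a + 1

radoNumberᴾ : Poly → Poly
radoNumberᴾ a = a *ᴾ (a *ᴾ (a +ᴾ [ 5 ]) +ᴾ [ 7 ]) +ᴾ [ 1 ]

⟦radoNumberᴾ⟧ : ∀ a x → ⟦ radoNumberᴾ a ⟧ x ≡ radoNumber (⟦ a ⟧ x)
⟦radoNumberᴾ⟧ a x = begin
  ⟦ a *ᴾ (a *ᴾ (a +ᴾ [ 5 ]) +ᴾ [ 7 ]) +ᴾ [ 1 ] ⟧ x
    ≡⟨ ⟦*ᴾ+ᴾ⟧ a _ [ 1 ] x ⟩
  v * ⟦ a *ᴾ (a +ᴾ [ 5 ]) +ᴾ [ 7 ] ⟧ x + ⟦ [ 1 ] ⟧ x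
    ≡⟨ cong₂ (λ u w → v * u + w) (⟦*ᴾ+ᴾ⟧ a _ [ 7 ] x) (⟦[ 1 ]⟧ x) ⟩
  v * (v * ⟦ a +ᴾ [ 5 ] ⟧ x + ⟦ [ 7 ] ⟧ x) + 1
    ≡⟨ cong₂ (λ u w → v * (v * u + w) + 1) (⟦+ᴾ⟧ a [ 5 ] x) (⟦[ 7 ]⟧ x) ⟩
  v * (v * (v + ⟦ [ 5 ] ⟧ x) + 7) + 1
    ≡⟨ cong (λ u → v * (v * (v + u) + 7) + 1) (⟦[ 5 ]⟧ x) ⟩
  v * (v * (v + 5) + 7) + 1
    ≡⟨ horner v ⟩
  radoNumber v
    ∎
  where
  open ≡-Reasoning
  v : ℕ
  v = ⟦ a ⟧ x
  horner : ∀ u → u * (u * (u + 5) + 7) + 1 ≡ u ^ 3 + 5 * u ^ 2 + 7 * u + 1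
  horner = +-*-Solver.solve 1 (λ u → u :* (u :* (u :+ con 5) :+ con 7) :+ con 1
                                    := u :^ 3 :+ con 5 :* u :^ 2 :+ con 7 :* u :+ con 1) refl
    where open +-*-Solver

split : ∀ {n} → Poly → (t₀ t₁ t₂ : Certificate 3 (suc n)) → Certificate 3 n
split p t₀ t₁ t₂ = branch p (Vec.lookup (t₀ ∷ t₁ ∷ t₂ ∷ []))

mono : ∀ {n} (i j l : ℕ) {i<n : True (i <? n)} {j<n : True (j <? n)} {l<n : True (l <? n)} →
       Certificate 3 n
mono i j l {i<n} {j<n} {l<n} = monoSol ((# i) {m<n = i<n}) ((# j) {m<n = j<n}) ((# l) {m<n = l<n})

upperCertificate : Certificate 3 1
upperCertificate =
  split (4 ∷ 4 ∷ 1 ∷ []) (mono 1 1 0) (split (1 ∷ []) (mono 0 0 2) (split (10 ∷ 15 ∷ 7 ∷ 1 ∷ [])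
  (split (8 ∷ 12 ∷ 6 ∷ 1 ∷ []) (mono 4 0 1) (mono 3 3 0) (split (5 ∷ 5 ∷ 1 ∷ []) (mono 0 0 2)
  (mono 3 4 0) (split (3 ∷ 1 ∷ []) (split (6 ∷ 6 ∷ 1 ∷ []) (split (3 ∷ 2 ∷ []) (mono 2 0 1)
  (split (4 ∷ 3 ∷ []) (mono 9 0 2) (mono 7 1 0) (split (1 ∷ 1 ∷ []) (split (4 ∷ 5 ∷ 1 ∷ [])
  (mono 0 4 8) (split (8 ∷ 13 ∷ 7 ∷ 1 ∷ []) (mono 5 12 0) (mono 1 11 0) (split (3 ∷ 3 ∷ 1 ∷ [])
  (mono 3 13 0) (mono 11 0 12) (mono 8 0 1))) (mono 0 2 7)) (mono 0 2 9) (mono 0 1 5)))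
  (mono 3 0 4)) (split (12 ∷ 18 ∷ 8 ∷ 1 ∷ []) (mono 8 5 0) (mono 1 1 0) (split (5 ∷ 6 ∷ 2 ∷ [])
  (split (3 ∷ 3 ∷ 1 ∷ []) (mono 10 0 1) (mono 8 0 9) (split (3 ∷ 2 ∷ []) (mono 0 11 2)
  (split (7 ∷ 9 ∷ 3 ∷ []) (mono 12 3 0) (mono 1 11 0) (split (5 ∷ 4 ∷ 1 ∷ []) (mono 13 7 0)
  (split (6 ∷ 5 ∷ 1 ∷ []) (mono 8 8 0) (mono 12 1 0) (split (9 ∷ 14 ∷ 7 ∷ 1 ∷ [])
  (split (6 ∷ 7 ∷ 2 ∷ []) (split (3 ∷ 4 ∷ 1 ∷ []) (mono 0 1 2) (split (7 ∷ 11 ∷ 6 ∷ 1 ∷ [])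
  (mono 12 0 15) (mono 1 17 0) (split (4 ∷ 5 ∷ 2 ∷ []) (split (2 ∷ []) (mono 0 1 4) (mono 0 19 13)
  (split (2 ∷ 2 ∷ []) (mono 0 21 2) (split (6 ∷ 8 ∷ 3 ∷ []) (mono 22 3 0) (mono 1 21 0)
  (split (8 ∷ 10 ∷ 3 ∷ []) (mono 17 14 0) (mono 2 16 0) (mono 3 1 0))) (mono 0 16 9))) (mono 8 17 0)
  (mono 9 0 1))) (mono 0 12 13)) (mono 5 5 0) (mono 2 0 8)) (mono 8 4 0) (mono 1 5 0)))
  (mono 0 1 5))) (mono 6 0 7))) (split (4 ∷ 2 ∷ []) (split (7 ∷ 6 ∷ 1 ∷ []) (mono 5 1 0)
  (split (6 ∷ 7 ∷ 2 ∷ []) (mono 2 12 0) (mono 10 3 0) (split (6 ∷ 5 ∷ 1 ∷ []) (mono 7 7 0)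
  (mono 11 0 2) (mono 0 1 5))) (mono 0 6 3)) (mono 0 8 1) (mono 0 6 2)) (split (3 ∷ 3 ∷ 1 ∷ [])
  (split (10 ∷ 16 ∷ 8 ∷ 1 ∷ []) (split (7 ∷ 6 ∷ 1 ∷ []) (mono 0 2 1) (split (13 ∷ 19 ∷ 8 ∷ 1 ∷ [])
  (mono 7 10 0) (mono 1 6 0) (split (8 ∷ 6 ∷ 1 ∷ []) (mono 0 14 11) (split (7 ∷ 5 ∷ 1 ∷ [])
  (mono 0 5 12) (mono 13 0 1) (mono 0 6 7)) (mono 0 9 1))) (mono 0 7 4)) (mono 4 10 0) (mono 6 2 0))
  (mono 8 0 9) (mono 0 1 6)))) (split (12 ∷ 18 ∷ 8 ∷ 1 ∷ []) (mono 8 5 0)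
  (split (13 ∷ 19 ∷ 8 ∷ 1 ∷ []) (mono 3 6 0) (mono 7 1 0) (split (8 ∷ 6 ∷ 1 ∷ []) (mono 0 10 7)
  (mono 0 9 2) (mono 0 5 1))) (mono 1 1 0))) (mono 0 4 5) (split (5 ∷ 8 ∷ 5 ∷ 1 ∷ [])
  (split (3 ∷ 4 ∷ 1 ∷ []) (mono 0 8 1) (split (7 ∷ 11 ∷ 6 ∷ 1 ∷ []) (mono 9 2 0) (mono 1 8 0)
  (split (4 ∷ 7 ∷ 5 ∷ 1 ∷ []) (split (2 ∷ 4 ∷ 1 ∷ []) (mono 0 11 1) (split (6 ∷ 10 ∷ 6 ∷ 1 ∷ [])
  (mono 12 2 0) (mono 1 11 0) (split (3 ∷ 6 ∷ 5 ∷ 1 ∷ []) (split (2 ∷ []) (mono 0 1 7)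
  (split (1 ∷ 4 ∷ 1 ∷ []) (mono 0 15 2) (split (5 ∷ 9 ∷ 6 ∷ 1 ∷ []) (mono 16 3 0) (mono 1 15 0)
  (split (2 ∷ 5 ∷ 5 ∷ 1 ∷ []) (split (3 ∷ []) (mono 0 1 11) (split (5 ∷ 2 ∷ []) (mono 0 12 16)
  (mono 5 1 0) (split (8 ∷ 6 ∷ 1 ∷ []) (mono 0 20 17) (split (12 ∷ 18 ∷ 8 ∷ 1 ∷ []) (mono 21 18 0)
  (mono 1 20 0) (mono 2 12 0)) (mono 14 1 0))) (mono 0 2 14)) (mono 2 15 0) (mono 11 0 1)))
  (mono 0 10 3)) (mono 0 2 10)) (mono 2 11 0) (mono 7 0 1))) (mono 0 6 2)) (mono 2 8 0)
  (mono 4 0 1))) (mono 0 3 4)) (mono 6 5 0) (mono 1 0 3))))) (split (3 ∷ 1 ∷ [])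
  (split (5 ∷ 5 ∷ 1 ∷ []) (mono 1 5 0) (mono 3 4 0) (split (6 ∷ 5 ∷ 1 ∷ []) (mono 2 2 0)
  (mono 0 5 3) (split (11 ∷ 16 ∷ 7 ∷ 1 ∷ []) (split (8 ∷ 12 ∷ 6 ∷ 1 ∷ []) (mono 4 0 1) (mono 7 7 0)
  (split (6 ∷ 9 ∷ 5 ∷ 1 ∷ []) (split (3 ∷ 3 ∷ 1 ∷ []) (mono 0 0 1) (mono 8 0 9)
  (split (9 ∷ 14 ∷ 7 ∷ 1 ∷ []) (split (2 ∷ []) (mono 0 1 5) (split (3 ∷ 2 ∷ []) (mono 0 4 2)
  (mono 1 11 0) (mono 8 0 5)) (mono 0 2 7)) (mono 9 0 8) (mono 5 1 0))) (split (5 ∷ 4 ∷ 1 ∷ [])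
  (mono 10 6 0) (mono 0 8 1) (split (3 ∷ 3 ∷ 1 ∷ []) (split (6 ∷ 7 ∷ 2 ∷ []) (mono 8 1 0)
  (mono 11 0 9) (split (1 ∷ 1 ∷ []) (mono 0 13 2) (split (2 ∷ 3 ∷ 1 ∷ [])
  (split (5 ∷ 8 ∷ 5 ∷ 1 ∷ []) (mono 1 4 0) (mono 14 13 0) (split (3 ∷ 2 ∷ [])
  (split (5 ∷ 7 ∷ 4 ∷ 1 ∷ []) (mono 6 17 0) (mono 4 0 8) (split (9 ∷ 13 ∷ 6 ∷ 1 ∷ []) (mono 18 0 11)
  (mono 5 0 15) (split (11 ∷ 17 ∷ 8 ∷ 1 ∷ []) (split (9 ∷ 14 ∷ 7 ∷ 1 ∷ []) (mono 20 0 1)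
  (mono 18 0 17) (split (4 ∷ 2 ∷ []) (split (7 ∷ 10 ∷ 5 ∷ 1 ∷ []) (mono 1 0 15) (mono 20 13 0)
  (split (7 ∷ 11 ∷ 6 ∷ 1 ∷ []) (mono 2 0 4) (mono 10 14 0) (split (2 ∷ []) (mono 0 0 3)
  (split (2 ∷ 2 ∷ []) (split (2 ∷ 2 ∷ 1 ∷ []) (split (4 ∷ 5 ∷ 2 ∷ []) (mono 27 1 0)
  (split (8 ∷ 13 ∷ 7 ∷ 1 ∷ []) (mono 24 0 9) (mono 27 1 0) (split (3 ∷ 4 ∷ 2 ∷ [])
  (split (1 ∷ 2 ∷ []) (mono 0 30 1) (split (5 ∷ 6 ∷ 3 ∷ 1 ∷ []) (mono 5 15 0) (mono 1 0 22)
  (split (2 ∷ 3 ∷ []) (split (9 ∷ 12 ∷ 5 ∷ 1 ∷ []) (mono 1 0 14) (mono 3 0 30)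
  (split (4 ∷ 5 ∷ 1 ∷ []) (mono 34 9 0) (split (5 ∷ 6 ∷ 1 ∷ []) (mono 31 10 0) (mono 33 1 0)
  (split (3 ∷ 3 ∷ []) (split (5 ∷ 9 ∷ 6 ∷ 1 ∷ []) (mono 23 8 0) (mono 3 35 0)
  (split (6 ∷ 7 ∷ 1 ∷ []) (mono 34 2 0) (mono 14 4 0) (split (6 ∷ 6 ∷ 1 ∷ []) (mono 35 23 0)
  (mono 5 0 36) (split (12 ∷ 17 ∷ 7 ∷ 1 ∷ []) (split (10 ∷ 14 ∷ 6 ∷ 1 ∷ []) (mono 41 0 1)
  (split (4 ∷ 1 ∷ []) (split (7 ∷ 12 ∷ 7 ∷ 1 ∷ []) (mono 1 0 24) (mono 13 34 0)
  (split (1 ∷ 1 ∷ 1 ∷ []) (mono 44 0 15) (split (3 ∷ []) (split (9 ∷ 12 ∷ 4 ∷ []) (mono 32 0 27)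
  (mono 2 0 5) (split (5 ∷ 3 ∷ 1 ∷ []) (mono 47 2 0) (mono 0 3 38) (split (10 ∷ 13 ∷ 5 ∷ 1 ∷ [])
  (mono 23 0 8) (split (14 ∷ 20 ∷ 8 ∷ 1 ∷ []) (mono 45 42 0) (split (13 ∷ 19 ∷ 8 ∷ 1 ∷ [])
  (mono 50 43 0) (mono 48 0 1) (split (4 ∷ 3 ∷ []) (split (8 ∷ 8 ∷ 1 ∷ []) (mono 10 1 0)
  (split (7 ∷ 6 ∷ []) (mono 8 2 0) (mono 40 0 1) (mono 15 0 3)) (mono 17 0 2)) (mono 0 3 2)
  (mono 0 34 31))) (mono 2 3 0)) (mono 1 43 0)))) (mono 0 1 44) (mono 0 8 37)) (mono 38 0 1)))
  (mono 0 33 1) (mono 0 25 9)) (mono 31 36 0)) (mono 16 37 0) (mono 34 1 0))))) (mono 23 0 2)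
  (mono 0 19 8))) (mono 0 29 14))) (mono 30 2 0) (mono 0 1 9))) (mono 0 8 2)) (mono 27 0 2)
  (mono 19 0 1))) (mono 17 0 7)) (mono 13 24 0) (mono 16 0 3)) (mono 23 12 0) (mono 0 8 2))
  (mono 0 1 6)))) (mono 0 12 18) (mono 0 6 1))) (mono 6 16 0) (mono 14 7 0)))) (mono 3 0 15)
  (mono 11 0 8))) (mono 0 13 5) (mono 0 2 6)) (mono 0 8 1))) (mono 9 0 10) (mono 1 0 3)))
  (split (3 ∷ 3 ∷ 1 ∷ []) (split (6 ∷ 7 ∷ 2 ∷ []) (mono 7 1 0) (mono 10 0 8) (split (1 ∷ 1 ∷ [])
  (mono 0 12 2) (split (2 ∷ 3 ∷ 1 ∷ []) (split (3 ∷ 2 ∷ []) (split (9 ∷ 13 ∷ 6 ∷ 1 ∷ [])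
  (mono 15 0 8) (mono 3 0 12) (split (11 ∷ 17 ∷ 8 ∷ 1 ∷ []) (split (9 ∷ 14 ∷ 7 ∷ 1 ∷ [])
  (mono 17 0 1) (mono 15 0 14) (split (5 ∷ 8 ∷ 5 ∷ 1 ∷ []) (mono 5 8 0) (mono 17 16 0)
  (split (7 ∷ 5 ∷ 1 ∷ []) (split (4 ∷ 1 ∷ []) (mono 16 0 1) (split (5 ∷ 2 ∷ []) (mono 21 0 2)
  (mono 19 1 0) (split (14 ∷ 20 ∷ 8 ∷ 1 ∷ []) (mono 18 15 0) (mono 2 19 0) (mono 1 7 0)))
  (mono 0 2 5)) (split (8 ∷ 6 ∷ 1 ∷ []) (mono 0 10 4) (mono 18 1 0) (split (13 ∷ 19 ∷ 8 ∷ 1 ∷ [])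
  (mono 21 14 0) (split (14 ∷ 20 ∷ 8 ∷ 1 ∷ []) (mono 18 15 0) (mono 20 1 0) (split (9 ∷ 11 ∷ 3 ∷ [])
  (mono 10 0 16) (mono 22 0 2) (split (5 ∷ 4 ∷ 1 ∷ []) (mono 24 20 0) (split (8 ∷ 10 ∷ 3 ∷ [])
  (mono 15 0 18) (mono 1 0 4) (split (6 ∷ 4 ∷ 1 ∷ []) (split (8 ∷ 13 ∷ 6 ∷ 1 ∷ []) (mono 1 14 0)
  (mono 8 15 0) (split (2 ∷ 2 ∷ []) (split (4 ∷ 5 ∷ 1 ∷ []) (mono 29 1 0) (split (6 ∷ 6 ∷ 1 ∷ [])
  (mono 26 16 0) (mono 1 0 27) (mono 10 0 8)) (mono 0 24 12)) (mono 26 16 0) (mono 22 0 1)))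
  (mono 24 0 7) (mono 0 1 4))) (mono 0 1 2)))) (mono 1 16 0))) (split (13 ∷ 19 ∷ 8 ∷ 1 ∷ [])
  (mono 20 13 0) (split (14 ∷ 20 ∷ 8 ∷ 1 ∷ []) (mono 17 14 0) (mono 19 1 0) (split (9 ∷ 11 ∷ 3 ∷ [])
  (mono 9 0 15) (mono 21 0 2) (split (5 ∷ 4 ∷ 1 ∷ []) (mono 23 19 0) (split (4 ∷ 2 ∷ [])
  (split (7 ∷ 8 ∷ 2 ∷ []) (mono 1 11 0) (split (8 ∷ 9 ∷ 2 ∷ []) (split (3 ∷ 4 ∷ 1 ∷ [])
  (mono 0 1 20) (mono 0 2 24) (mono 0 22 19)) (mono 24 1 0) (mono 20 0 5)) (mono 6 0 4))
  (mono 12 0 1) (mono 0 6 7)) (mono 0 1 2)))) (mono 1 9 0))))) (mono 4 13 0) (mono 11 5 0)))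
  (mono 2 0 13) (mono 9 0 6)) (mono 1 1 0) (mono 0 2 5)) (mono 0 7 1))) (mono 8 0 9) (mono 0 0 1))))
  (mono 5 4 0) (mono 1 2 0)))) (mono 0 2 3) (split (6 ∷ 5 ∷ 1 ∷ []) (split (8 ∷ 12 ∷ 6 ∷ 1 ∷ [])
  (mono 1 6 0) (mono 5 5 0) (split (5 ∷ 8 ∷ 5 ∷ 1 ∷ []) (split (11 ∷ 16 ∷ 7 ∷ 1 ∷ [])
  (split (5 ∷ 5 ∷ 1 ∷ []) (mono 4 0 1) (mono 7 8 0) (split (3 ∷ 4 ∷ 1 ∷ []) (mono 0 10 3)
  (split (7 ∷ 11 ∷ 6 ∷ 1 ∷ []) (mono 11 4 0) (mono 1 10 0) (split (4 ∷ 7 ∷ 5 ∷ 1 ∷ [])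
  (split (2 ∷ 4 ∷ 1 ∷ []) (mono 0 13 1) (split (6 ∷ 10 ∷ 6 ∷ 1 ∷ []) (mono 14 2 0) (mono 1 13 0)
  (split (9 ∷ 14 ∷ 7 ∷ 1 ∷ []) (split (2 ∷ []) (mono 0 1 8) (split (3 ∷ 3 ∷ 1 ∷ []) (mono 12 0 2)
  (mono 15 0 16) (split (6 ∷ 7 ∷ 2 ∷ []) (split (3 ∷ 2 ∷ []) (mono 0 0 1) (split (5 ∷ 4 ∷ 1 ∷ [])
  (mono 0 2 12) (split (7 ∷ 6 ∷ 1 ∷ []) (mono 0 21 6) (mono 5 1 0) (split (8 ∷ 11 ∷ 5 ∷ 1 ∷ [])
  (split (9 ∷ 13 ∷ 6 ∷ 1 ∷ []) (mono 23 0 15) (mono 3 22 0) (split (5 ∷ 6 ∷ 2 ∷ [])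
  (split (3 ∷ 2 ∷ 1 ∷ []) (mono 0 1 3) (mono 9 0 5) (split (6 ∷ 4 ∷ 1 ∷ []) (mono 0 2 18)
  (split (4 ∷ 5 ∷ 2 ∷ []) (split (6 ∷ 8 ∷ 3 ∷ []) (mono 28 1 0) (split (12 ∷ 18 ∷ 8 ∷ 1 ∷ [])
  (mono 24 11 0) (mono 3 1 0) (mono 8 20 0)) (mono 3 0 5)) (mono 1 0 24) (mono 10 0 16))
  (mono 0 9 3))) (mono 4 0 21) (mono 7 0 18))) (mono 2 3 0) (mono 5 13 0))) (mono 0 3 14))
  (mono 10 0 13)) (mono 17 0 15) (mono 14 1 0))) (mono 0 2 10)) (mono 13 0 12) (mono 11 1 0)))
  (mono 0 4 2)) (mono 2 10 0) (mono 8 0 1))) (mono 0 1 4))) (mono 6 5 0) (mono 4 2 0)) (mono 6 5 0)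
  (mono 3 0 1))) (mono 0 4 2) (mono 1 1 0))) (split (5 ∷ 5 ∷ 1 ∷ []) (split (3 ∷ 1 ∷ [])
  (mono 0 5 1) (mono 0 3 4) (split (7 ∷ 11 ∷ 6 ∷ 1 ∷ []) (mono 2 6 0) (split (6 ∷ 5 ∷ 1 ∷ [])
  (split (8 ∷ 12 ∷ 6 ∷ 1 ∷ []) (mono 1 8 0) (mono 7 7 0) (split (5 ∷ 8 ∷ 5 ∷ 1 ∷ [])
  (split (11 ∷ 16 ∷ 7 ∷ 1 ∷ []) (mono 3 6 0) (split (7 ∷ 8 ∷ 2 ∷ []) (mono 11 7 0) (mono 10 0 1)
  (split (3 ∷ 4 ∷ 1 ∷ []) (mono 0 12 3) (mono 0 11 6) (mono 0 1 9))) (mono 5 2 0)) (mono 8 7 0)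
  (mono 4 0 1))) (mono 0 5 1) (mono 2 2 0)) (mono 1 0 3))) (mono 2 3 0) (mono 0 0 1)))
  (split (8 ∷ 12 ∷ 6 ∷ 1 ∷ []) (split (6 ∷ 5 ∷ 1 ∷ []) (mono 0 4 1) (split (10 ∷ 15 ∷ 7 ∷ 1 ∷ [])
  (mono 5 2 0) (mono 1 4 0) (split (5 ∷ 5 ∷ 1 ∷ []) (split (3 ∷ 1 ∷ []) (mono 0 7 1) (mono 0 0 3)
  (split (7 ∷ 11 ∷ 6 ∷ 1 ∷ []) (mono 2 8 0) (split (3 ∷ 4 ∷ 1 ∷ []) (mono 0 3 6) (mono 0 8 1)
  (split (7 ∷ 8 ∷ 2 ∷ []) (mono 10 4 0) (split (11 ∷ 16 ∷ 7 ∷ 1 ∷ []) (split (13 ∷ 19 ∷ 8 ∷ 1 ∷ [])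
  (mono 12 1 0) (mono 8 2 0) (mono 5 7 0)) (mono 10 1 0) (mono 9 6 0)) (mono 1 0 5))) (mono 1 0 3)))
  (split (9 ∷ 14 ∷ 7 ∷ 1 ∷ []) (split (11 ∷ 16 ∷ 7 ∷ 1 ∷ []) (split (3 ∷ 1 ∷ []) (mono 0 6 1)
  (mono 0 0 5) (split (2 ∷ []) (mono 0 3 2) (split (13 ∷ 19 ∷ 8 ∷ 1 ∷ []) (mono 11 3 0)
  (split (4 ∷ 2 ∷ []) (split (11 ∷ 17 ∷ 8 ∷ 1 ∷ []) (mono 13 6 0) (mono 3 0 2)
  (split (12 ∷ 18 ∷ 8 ∷ 1 ∷ []) (mono 2 11 0) (split (7 ∷ 6 ∷ 1 ∷ []) (mono 0 15 8) (mono 0 9 1)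
  (split (8 ∷ 7 ∷ 1 ∷ []) (split (4 ∷ 1 ∷ []) (mono 0 5 1) (mono 0 7 13) (mono 0 8 2)) (mono 6 12 0)
  (mono 14 1 0))) (mono 12 1 0))) (mono 2 2 0) (mono 10 3 0)) (mono 2 6 0)) (mono 8 0 1)))
  (mono 4 2 0) (mono 6 3 0)) (mono 1 6 0) (mono 5 0 2)) (mono 0 0 1))) (split (5 ∷ 5 ∷ 1 ∷ [])
  (split (3 ∷ 1 ∷ []) (mono 0 6 1) (split (7 ∷ 11 ∷ 6 ∷ 1 ∷ []) (mono 2 7 0)
  (split (10 ∷ 15 ∷ 7 ∷ 1 ∷ []) (mono 8 5 0) (mono 2 1 0) (split (3 ∷ 4 ∷ 1 ∷ []) (mono 0 4 6)
  (mono 0 8 2) (split (7 ∷ 8 ∷ 2 ∷ []) (mono 10 5 0) (mono 4 9 0) (mono 1 0 2)))) (mono 3 5 0))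
  (mono 0 0 2)) (split (10 ∷ 15 ∷ 7 ∷ 1 ∷ []) (mono 6 3 0) (mono 1 1 0) (split (9 ∷ 14 ∷ 7 ∷ 1 ∷ [])
  (split (7 ∷ 11 ∷ 6 ∷ 1 ∷ []) (mono 8 0 1) (split (7 ∷ 6 ∷ 1 ∷ []) (mono 0 9 2)
  (split (11 ∷ 17 ∷ 8 ∷ 1 ∷ []) (mono 10 3 0) (mono 1 9 0) (split (12 ∷ 18 ∷ 8 ∷ 1 ∷ [])
  (split (1 ∷ 1 ∷ []) (mono 0 9 5) (split (5 ∷ 6 ∷ 2 ∷ []) (split (6 ∷ 9 ∷ 5 ∷ 1 ∷ [])
  (mono 14 0 11) (mono 2 0 6) (split (3 ∷ 3 ∷ 1 ∷ []) (mono 15 0 2) (split (3 ∷ 2 ∷ [])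
  (mono 0 16 3) (mono 4 0 15) (split (9 ∷ 13 ∷ 6 ∷ 1 ∷ []) (split (11 ∷ 16 ∷ 7 ∷ 1 ∷ [])
  (mono 18 1 0) (split (7 ∷ 5 ∷ 1 ∷ []) (mono 0 6 8) (mono 0 18 1) (split (10 ∷ 14 ∷ 6 ∷ 1 ∷ [])
  (split (2 ∷ []) (mono 0 18 1) (mono 0 6 16) (mono 0 19 5)) (mono 8 0 2) (mono 1 4 0)))
  (mono 16 12 0)) (mono 16 12 0) (mono 13 1 0))) (mono 0 0 1))) (mono 1 12 0) (mono 9 0 3))
  (mono 0 6 2)) (mono 2 6 0) (mono 9 1 0))) (mono 7 5 0)) (mono 4 6 0)) (mono 2 6 0) (mono 5 0 1)))
  (split (10 ∷ 15 ∷ 7 ∷ 1 ∷ []) (mono 6 3 0) (split (3 ∷ 3 ∷ 1 ∷ []) (split (5 ∷ 4 ∷ 1 ∷ [])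
  (mono 0 1 5) (split (5 ∷ 6 ∷ 2 ∷ []) (mono 9 2 0) (mono 1 0 3) (split (6 ∷ 7 ∷ 2 ∷ [])
  (split (4 ∷ 2 ∷ []) (mono 0 11 1) (split (9 ∷ 13 ∷ 6 ∷ 1 ∷ []) (mono 5 2 0) (mono 4 11 0)
  (split (3 ∷ 2 ∷ []) (mono 0 0 3) (split (7 ∷ 6 ∷ 1 ∷ []) (split (10 ∷ 16 ∷ 8 ∷ 1 ∷ [])
  (mono 1 8 0) (split (7 ∷ 11 ∷ 6 ∷ 1 ∷ []) (split (6 ∷ 10 ∷ 6 ∷ 1 ∷ []) (split (4 ∷ 5 ∷ 2 ∷ [])
  (mono 11 0 2) (split (8 ∷ 13 ∷ 7 ∷ 1 ∷ []) (mono 19 2 0) (mono 18 1 0)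
  (split (9 ∷ 14 ∷ 7 ∷ 1 ∷ []) (mono 6 20 0) (mono 12 2 0) (mono 18 1 0))) (mono 16 0 9))
  (mono 6 0 2) (mono 12 15 0)) (mono 3 0 1) (mono 12 14 0)) (mono 10 6 0)) (mono 0 1 8)
  (mono 12 10 0)) (mono 9 0 1))) (mono 0 9 2)) (mono 9 0 4) (mono 8 1 0))) (mono 6 0 4))
  (split (6 ∷ 9 ∷ 5 ∷ 1 ∷ []) (mono 8 0 5) (mono 1 1 0) (split (7 ∷ 11 ∷ 6 ∷ 1 ∷ [])
  (split (5 ∷ 8 ∷ 5 ∷ 1 ∷ []) (mono 10 0 1) (split (7 ∷ 10 ∷ 5 ∷ 1 ∷ []) (split (1 ∷ 3 ∷ 1 ∷ [])
  (split (6 ∷ 6 ∷ 1 ∷ []) (mono 1 0 2) (split (6 ∷ 7 ∷ 2 ∷ []) (mono 2 0 5) (mono 13 0 8)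
  (split (5 ∷ 2 ∷ []) (split (12 ∷ 18 ∷ 8 ∷ 1 ∷ []) (mono 1 7 0) (mono 3 3 0) (mono 12 2 0))
  (mono 0 5 9) (mono 0 13 1))) (mono 11 8 0)) (mono 0 11 2) (mono 0 7 4)) (mono 4 10 0)
  (mono 9 3 0)) (mono 8 0 2)) (mono 8 2 0) (mono 5 7 0))) (split (2 ∷ [])
  (split (6 ∷ 10 ∷ 6 ∷ 1 ∷ []) (mono 1 0 6) (split (4 ∷ 1 ∷ []) (split (2 ∷ 2 ∷ 1 ∷ [])
  (split (6 ∷ 7 ∷ 2 ∷ []) (mono 2 1 0) (mono 11 0 6) (split (6 ∷ 6 ∷ 1 ∷ []) (mono 3 13 0)
  (split (12 ∷ 18 ∷ 8 ∷ 1 ∷ []) (split (10 ∷ 16 ∷ 8 ∷ 1 ∷ []) (mono 7 0 1) (mono 2 14 0)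
  (split (8 ∷ 13 ∷ 7 ∷ 1 ∷ []) (mono 6 0 2) (split (4 ∷ 5 ∷ 2 ∷ []) (mono 17 6 0) (mono 16 0 1)
  (mono 13 0 2)) (mono 11 9 0))) (mono 1 1 0) (mono 10 2 0)) (mono 11 8 0))) (mono 10 0 2)
  (mono 9 0 4)) (mono 0 1 4) (mono 0 8 5)) (mono 4 7 0)) (split (6 ∷ 6 ∷ 1 ∷ [])
  (split (8 ∷ 13 ∷ 7 ∷ 1 ∷ []) (mono 1 10 0) (mono 2 0 4) (mono 5 3 0)) (mono 1 8 0) (mono 7 4 0))
  (mono 0 1 3))) (mono 1 1 0)))) (mono 2 2 0) (split (7 ∷ 5 ∷ 1 ∷ []) (split (9 ∷ 13 ∷ 6 ∷ 1 ∷ [])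
  (mono 1 5 0) (split (3 ∷ 4 ∷ 1 ∷ []) (split (3 ∷ 2 ∷ []) (split (5 ∷ 5 ∷ 1 ∷ []) (mono 8 1 0)
  (mono 7 0 3) (split (1 ∷ 1 ∷ []) (mono 9 0 3) (split (5 ∷ 6 ∷ 2 ∷ []) (mono 3 10 0) (mono 1 9 0)
  (split (10 ∷ 15 ∷ 7 ∷ 1 ∷ []) (split (6 ∷ 7 ∷ 2 ∷ []) (mono 5 5 0) (split (3 ∷ 3 ∷ 1 ∷ [])
  (mono 9 0 2) (mono 0 1 8) (mono 0 3 10)) (mono 10 2 0)) (mono 2 6 0) (mono 3 3 0)))
  (split (6 ∷ 7 ∷ 2 ∷ []) (mono 3 3 0) (split (10 ∷ 15 ∷ 7 ∷ 1 ∷ []) (split (3 ∷ 3 ∷ 1 ∷ [])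
  (mono 8 0 1) (mono 0 2 7) (split (6 ∷ 9 ∷ 5 ∷ 1 ∷ []) (mono 7 6 0) (split (5 ∷ 4 ∷ 1 ∷ [])
  (split (8 ∷ 11 ∷ 5 ∷ 1 ∷ []) (mono 1 8 0) (split (2 ∷ []) (split (4 ∷ 3 ∷ []) (mono 1 17 0)
  (mono 16 0 2) (mono 8 0 9)) (mono 0 3 1) (mono 0 4 8)) (mono 3 7 0)) (mono 0 13 9) (mono 0 2 11))
  (mono 1 1 0))) (mono 10 1 0) (mono 3 3 0)) (mono 1 2 0)))) (split (1 ∷ 1 ∷ []) (mono 8 0 2)
  (mono 0 1 7) (split (7 ∷ 10 ∷ 5 ∷ 1 ∷ []) (split (5 ∷ 4 ∷ 1 ∷ []) (mono 0 10 1) (mono 0 9 5)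
  (split (6 ∷ 5 ∷ 1 ∷ []) (split (4 ∷ 2 ∷ []) (mono 12 0 1) (split (5 ∷ 7 ∷ 4 ∷ 1 ∷ [])
  (mono 13 0 4) (mono 1 0 8) (split (6 ∷ 8 ∷ 4 ∷ 1 ∷ []) (split (4 ∷ 3 ∷ 1 ∷ []) (mono 0 15 1)
  (split (8 ∷ 11 ∷ 5 ∷ 1 ∷ []) (mono 16 2 0) (mono 1 15 0) (split (3 ∷ 1 ∷ []) (mono 0 0 6)
  (split (6 ∷ 6 ∷ 2 ∷ []) (split (8 ∷ 9 ∷ 3 ∷ []) (mono 19 1 0) (mono 7 4 0) (split (7 ∷ 7 ∷ 2 ∷ [])
  (split (13 ∷ 18 ∷ 8 ∷ 1 ∷ []) (mono 17 3 0) (split (9 ∷ 10 ∷ 3 ∷ []) (mono 22 2 0) (mono 21 0 1)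
  (mono 20 3 0)) (mono 11 2 0)) (mono 13 8 0) (mono 12 0 1))) (mono 11 1 0) (mono 10 8 0))
  (mono 0 4 1))) (mono 13 0 5)) (mono 7 0 9) (mono 12 1 0))) (mono 4 0 2)) (mono 0 4 6)
  (mono 9 1 0))) (mono 8 2 0) (mono 1 0 6))) (split (5 ∷ 5 ∷ 1 ∷ []) (split (7 ∷ 11 ∷ 6 ∷ 1 ∷ [])
  (mono 1 9 0) (split (2 ∷ []) (split (4 ∷ 3 ∷ []) (mono 1 11 0) (split (3 ∷ 3 ∷ 1 ∷ [])
  (mono 2 0 4) (mono 11 0 3) (split (5 ∷ 4 ∷ 1 ∷ []) (split (1 ∷ 1 ∷ []) (mono 14 0 8)
  (split (10 ∷ 15 ∷ 7 ∷ 1 ∷ []) (mono 7 7 0) (mono 1 10 0) (split (7 ∷ 6 ∷ 1 ∷ []) (mono 6 3 0)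
  (split (11 ∷ 17 ∷ 8 ∷ 1 ∷ []) (split (9 ∷ 14 ∷ 7 ∷ 1 ∷ []) (mono 18 0 1) (split (4 ∷ 5 ∷ 2 ∷ [])
  (mono 15 0 2) (split (5 ∷ 3 ∷ 1 ∷ []) (mono 10 0 16) (mono 0 1 15) (split (5 ∷ 7 ∷ 3 ∷ [])
  (split (3 ∷ 4 ∷ 2 ∷ []) (mono 22 0 1) (split (6 ∷ 4 ∷ 1 ∷ []) (mono 0 2 6) (mono 0 1 5)
  (mono 21 3 0)) (mono 2 0 19)) (mono 7 2 0) (mono 1 0 6))) (mono 12 17 0)) (mono 16 0 3))
  (mono 1 16 0) (mono 10 14 0)) (mono 0 9 1))) (split (7 ∷ 10 ∷ 5 ∷ 1 ∷ []) (mono 2 15 0)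
  (split (11 ∷ 17 ∷ 8 ∷ 1 ∷ []) (split (8 ∷ 10 ∷ 3 ∷ []) (mono 11 0 1) (mono 6 6 0)
  (split (6 ∷ 7 ∷ 2 ∷ []) (mono 10 0 2) (split (4 ∷ 5 ∷ 2 ∷ []) (mono 15 0 3)
  (split (5 ∷ 3 ∷ 1 ∷ []) (mono 10 0 16) (mono 0 1 15) (split (8 ∷ 11 ∷ 5 ∷ 1 ∷ [])
  (split (6 ∷ 4 ∷ 1 ∷ []) (mono 0 22 1) (split (12 ∷ 17 ∷ 7 ∷ 1 ∷ []) (mono 19 15 0) (mono 1 5 0)
  (split (4 ∷ 3 ∷ 1 ∷ []) (mono 24 14 0) (split (10 ∷ 13 ∷ 6 ∷ 1 ∷ []) (mono 12 12 0) (mono 3 1 0)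
  (split (7 ∷ 7 ∷ 2 ∷ []) (mono 26 13 0) (split (3 ∷ 1 ∷ []) (mono 0 27 19) (mono 0 3 1)
  (split (11 ∷ 15 ∷ 7 ∷ 1 ∷ []) (split (13 ∷ 18 ∷ 8 ∷ 1 ∷ []) (mono 29 1 0) (split (6 ∷ 5 ∷ 1 ∷ [])
  (mono 22 0 2) (mono 0 4 1) (mono 3 3 0)) (mono 22 4 0)) (mono 27 2 0) (mono 14 3 0)))
  (mono 14 0 1))) (mono 0 7 1))) (mono 20 2 0)) (mono 20 10 0) (mono 1 9 0))) (mono 12 17 0))
  (mono 11 11 0))) (mono 5 1 0) (mono 9 13 0)) (mono 1 0 12))) (mono 0 12 8) (mono 0 1 10)))
  (mono 9 4 0)) (mono 0 1 5) (mono 0 8 3)) (mono 7 0 6)) (mono 7 0 3) (mono 0 1 5)))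
  (split (7 ∷ 11 ∷ 6 ∷ 1 ∷ []) (split (5 ∷ 5 ∷ 1 ∷ []) (mono 0 8 1) (mono 7 0 3)
  (split (6 ∷ 6 ∷ 1 ∷ []) (split (4 ∷ 1 ∷ []) (mono 0 10 1) (split (8 ∷ 9 ∷ 2 ∷ []) (mono 11 2 0)
  (mono 1 10 0) (split (5 ∷ 8 ∷ 5 ∷ 1 ∷ []) (mono 12 0 5) (mono 2 0 7) (split (13 ∷ 18 ∷ 7 ∷ 1 ∷ [])
  (mono 9 4 0) (mono 3 8 0) (split (5 ∷ 4 ∷ 1 ∷ []) (split (3 ∷ 1 ∷ []) (mono 15 0 1)
  (split (12 ∷ 17 ∷ 7 ∷ 1 ∷ []) (split (7 ∷ 8 ∷ 2 ∷ []) (mono 3 0 1) (mono 2 16 0)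
  (split (6 ∷ 5 ∷ 1 ∷ []) (mono 0 9 2) (mono 3 3 0) (split (14 ∷ 20 ∷ 8 ∷ 1 ∷ []) (mono 19 3 0)
  (split (11 ∷ 16 ∷ 7 ∷ 1 ∷ []) (split (5 ∷ 2 ∷ []) (mono 21 0 17) (mono 0 16 2)
  (split (10 ∷ 12 ∷ 3 ∷ []) (split (12 ∷ 15 ∷ 4 ∷ []) (mono 23 1 0) (split (2 ∷ 3 ∷ 1 ∷ [])
  (mono 0 2 8) (mono 0 1 5) (split (11 ∷ 13 ∷ 3 ∷ []) (split (13 ∷ 16 ∷ 4 ∷ []) (mono 26 1 0)
  (split (1 ∷ 3 ∷ 1 ∷ []) (mono 0 5 7) (mono 0 1 8) (mono 0 10 24)) (mono 5 15 0)) (mono 19 0 6)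
  (mono 1 0 12))) (mono 2 6 0)) (mono 21 0 3) (mono 1 14 0))) (mono 5 0 1) (mono 2 12 0))
  (mono 1 8 0)))) (mono 1 11 0) (mono 14 0 3)) (mono 0 3 12)) (mono 0 13 9) (mono 0 3 1)))))
  (mono 0 8 2)) (mono 3 0 4) (mono 7 1 0))) (mono 1 6 0) (mono 5 0 4)) (split (5 ∷ 5 ∷ 1 ∷ [])
  (split (7 ∷ 8 ∷ 2 ∷ []) (mono 8 1 0) (split (3 ∷ 1 ∷ []) (mono 0 9 2) (mono 0 8 1)
  (split (11 ∷ 16 ∷ 7 ∷ 1 ∷ []) (split (6 ∷ 5 ∷ 1 ∷ []) (mono 0 4 1) (split (10 ∷ 15 ∷ 7 ∷ 1 ∷ [])
  (mono 5 5 0) (mono 1 11 0) (split (13 ∷ 19 ∷ 8 ∷ 1 ∷ []) (mono 13 3 0) (mono 2 5 0) (mono 4 1 0)))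
  (mono 2 2 0)) (mono 9 2 0) (mono 1 7 0))) (split (10 ∷ 15 ∷ 7 ∷ 1 ∷ []) (mono 2 2 0)
  (split (6 ∷ 7 ∷ 2 ∷ []) (split (1 ∷ 1 ∷ []) (mono 0 4 1) (mono 0 6 2) (split (8 ∷ 10 ∷ 3 ∷ [])
  (mono 12 2 0) (split (4 ∷ 2 ∷ []) (mono 0 13 3) (mono 0 12 1) (split (2 ∷ 3 ∷ 1 ∷ [])
  (split (7 ∷ 10 ∷ 5 ∷ 1 ∷ []) (mono 1 8 0) (split (3 ∷ 2 ∷ []) (mono 16 0 9) (mono 0 1 7)
  (mono 3 0 8)) (mono 4 0 12)) (mono 0 2 5) (mono 12 0 8))) (mono 1 4 0))) (mono 9 0 1)
  (mono 8 0 2)) (mono 3 1 0))) (mono 6 0 2) (mono 1 0 4))) (mono 3 2 0))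
  (split (11 ∷ 16 ∷ 7 ∷ 1 ∷ []) (split (9 ∷ 13 ∷ 6 ∷ 1 ∷ []) (mono 6 0 1)
  (split (7 ∷ 11 ∷ 6 ∷ 1 ∷ []) (split (5 ∷ 5 ∷ 1 ∷ []) (mono 0 8 1) (mono 7 0 2) (split (4 ∷ 1 ∷ [])
  (mono 0 2 4) (split (5 ∷ 8 ∷ 5 ∷ 1 ∷ []) (mono 10 0 3) (mono 1 0 4) (split (3 ∷ 1 ∷ [])
  (split (5 ∷ 4 ∷ 1 ∷ []) (mono 12 1 0) (mono 0 11 6) (split (10 ∷ 15 ∷ 7 ∷ 1 ∷ []) (mono 2 6 0)
  (split (6 ∷ 5 ∷ 1 ∷ []) (mono 3 3 0) (mono 0 13 1) (mono 12 2 0)) (mono 5 5 0))) (mono 0 2 7)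
  (mono 0 1 8))) (mono 0 7 1))) (split (3 ∷ 2 ∷ []) (split (5 ∷ 5 ∷ 1 ∷ []) (mono 9 1 0)
  (mono 8 0 3) (split (3 ∷ 4 ∷ 1 ∷ []) (split (1 ∷ 1 ∷ []) (mono 11 0 1) (split (6 ∷ 9 ∷ 5 ∷ 1 ∷ [])
  (mono 2 4 0) (mono 1 0 5) (split (8 ∷ 11 ∷ 5 ∷ 1 ∷ []) (mono 5 0 8) (mono 2 0 7)
  (split (3 ∷ 3 ∷ 1 ∷ []) (split (6 ∷ 10 ∷ 6 ∷ 1 ∷ []) (mono 5 1 0) (split (5 ∷ 8 ∷ 5 ∷ 1 ∷ [])
  (mono 6 16 0) (mono 5 0 1) (mono 14 0 4)) (mono 6 13 0)) (mono 13 0 7) (mono 0 5 1))))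
  (split (6 ∷ 7 ∷ 2 ∷ []) (mono 4 4 0) (split (10 ∷ 15 ∷ 7 ∷ 1 ∷ []) (split (13 ∷ 19 ∷ 8 ∷ 1 ∷ [])
  (mono 14 9 0) (mono 10 2 0) (split (8 ∷ 6 ∷ 1 ∷ []) (mono 0 7 10) (split (12 ∷ 18 ∷ 8 ∷ 1 ∷ [])
  (mono 16 3 0) (mono 1 15 0) (mono 14 0 2)) (mono 0 6 1))) (mono 12 1 0) (mono 4 4 0))
  (mono 1 3 0))) (mono 0 9 3) (mono 0 1 7))) (split (1 ∷ 1 ∷ []) (split (12 ∷ 18 ∷ 8 ∷ 1 ∷ [])
  (mono 1 5 0) (mono 2 4 0) (split (3 ∷ 4 ∷ 1 ∷ []) (mono 11 2 0) (mono 0 10 4)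
  (split (5 ∷ 5 ∷ 1 ∷ []) (split (6 ∷ 7 ∷ 2 ∷ []) (mono 4 1 0) (mono 5 5 0) (split (6 ∷ 5 ∷ 1 ∷ [])
  (mono 0 2 9) (mono 0 6 8) (mono 0 1 4))) (mono 11 0 6) (mono 1 0 9)))) (mono 0 1 8)
  (split (7 ∷ 10 ∷ 5 ∷ 1 ∷ []) (split (5 ∷ 4 ∷ 1 ∷ []) (mono 0 11 1) (mono 0 10 5)
  (split (6 ∷ 5 ∷ 1 ∷ []) (split (3 ∷ 3 ∷ 1 ∷ []) (split (6 ∷ 9 ∷ 5 ∷ 1 ∷ []) (mono 1 1 0)
  (split (9 ∷ 14 ∷ 7 ∷ 1 ∷ []) (mono 3 2 0) (mono 7 1 0) (mono 6 12 0)) (mono 3 12 0)) (mono 12 0 6)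
  (mono 2 0 10)) (mono 0 4 6) (mono 10 1 0))) (mono 9 2 0) (mono 1 0 7))) (split (2 ∷ [])
  (split (5 ∷ 5 ∷ 1 ∷ []) (split (3 ∷ 3 ∷ 1 ∷ []) (mono 2 0 1) (mono 10 0 4) (split (5 ∷ 4 ∷ 1 ∷ [])
  (split (6 ∷ 7 ∷ 2 ∷ []) (mono 1 0 8) (split (13 ∷ 19 ∷ 8 ∷ 1 ∷ []) (mono 14 9 0) (mono 10 1 0)
  (split (10 ∷ 14 ∷ 6 ∷ 1 ∷ []) (mono 3 5 0) (split (6 ∷ 6 ∷ 1 ∷ []) (mono 6 0 11) (mono 15 0 1)
  (split (7 ∷ 7 ∷ 1 ∷ []) (mono 8 7 0) (split (3 ∷ []) (split (7 ∷ 6 ∷ 1 ∷ []) (mono 10 7 0)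
  (split (11 ∷ 17 ∷ 8 ∷ 1 ∷ []) (split (14 ∷ 20 ∷ 8 ∷ 1 ∷ []) (mono 3 1 0) (mono 2 4 0)
  (mono 19 7 0)) (mono 1 19 0) (mono 12 17 0)) (mono 0 3 5)) (mono 0 11 3) (mono 0 7 2))
  (mono 15 1 0))) (mono 7 0 1))) (mono 5 5 0)) (mono 0 11 6) (mono 0 1 9))) (mono 9 0 4)
  (mono 0 2 7)) (mono 0 2 3) (mono 0 7 1))) (mono 5 0 4)) (mono 4 3 0)) (mono 1 4 0)
  (split (5 ∷ 5 ∷ 1 ∷ []) (split (3 ∷ 1 ∷ []) (mono 0 7 1) (split (7 ∷ 11 ∷ 6 ∷ 1 ∷ []) (mono 2 8 0)
  (split (10 ∷ 15 ∷ 7 ∷ 1 ∷ []) (mono 3 3 0) (mono 2 1 0) (mono 7 0 4)) (mono 6 0 5)) (mono 0 4 2))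
  (split (9 ∷ 13 ∷ 6 ∷ 1 ∷ []) (split (10 ∷ 15 ∷ 7 ∷ 1 ∷ []) (split (12 ∷ 17 ∷ 7 ∷ 1 ∷ [])
  (split (3 ∷ 1 ∷ []) (mono 0 3 1) (split (3 ∷ 2 ∷ []) (split (6 ∷ 5 ∷ 1 ∷ []) (mono 0 1 5)
  (mono 2 2 0) (split (7 ∷ 6 ∷ 1 ∷ []) (mono 0 2 5) (split (12 ∷ 18 ∷ 8 ∷ 1 ∷ []) (mono 14 6 0)
  (mono 1 8 0) (split (1 ∷ 1 ∷ []) (mono 0 8 7) (split (6 ∷ 7 ∷ 2 ∷ []) (mono 5 5 0) (mono 1 10 0)
  (mono 4 0 2)) (mono 0 10 1))) (mono 11 1 0))) (split (1 ∷ 1 ∷ []) (mono 0 5 4) (mono 0 1 11)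
  (split (10 ∷ 14 ∷ 6 ∷ 1 ∷ []) (mono 13 0 4) (mono 9 2 0) (mono 1 0 8))) (split (2 ∷ [])
  (mono 0 4 3) (split (8 ∷ 6 ∷ 1 ∷ []) (mono 0 13 5) (split (12 ∷ 18 ∷ 8 ∷ 1 ∷ []) (mono 14 6 0)
  (mono 1 13 0) (split (1 ∷ 1 ∷ []) (mono 0 8 7) (split (4 ∷ 3 ∷ []) (split (6 ∷ 7 ∷ 2 ∷ [])
  (split (6 ∷ 4 ∷ 1 ∷ []) (mono 0 1 9) (mono 6 0 5) (split (7 ∷ 10 ∷ 5 ∷ 1 ∷ []) (mono 19 0 12)
  (split (5 ∷ 6 ∷ 2 ∷ []) (split (4 ∷ 3 ∷ 1 ∷ []) (mono 0 1 14) (mono 6 11 0)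
  (split (3 ∷ 2 ∷ 1 ∷ []) (split (5 ∷ 4 ∷ 1 ∷ []) (mono 0 3 15) (split (10 ∷ 13 ∷ 6 ∷ 1 ∷ [])
  (split (7 ∷ 8 ∷ 3 ∷ []) (mono 3 0 1) (split (2 ∷ 2 ∷ []) (mono 0 10 9) (mono 0 3 1)
  (split (10 ∷ 14 ∷ 6 ∷ 1 ∷ []) (mono 27 0 18) (mono 17 8 0) (mono 1 0 13))) (mono 14 4 0))
  (mono 20 14 0) (mono 6 3 0)) (mono 21 2 0)) (mono 7 10 0) (mono 20 0 1))) (mono 5 19 0)
  (mono 2 0 15)) (mono 1 17 0))) (mono 2 11 0) (mono 6 6 0)) (mono 1 0 10) (mono 14 5 0))
  (mono 0 10 1))) (mono 0 2 8)) (mono 0 10 1))) (mono 0 7 5)) (mono 5 3 0) (mono 7 4 0))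
  (mono 2 2 0) (mono 6 0 3)) (mono 6 1 0) (mono 5 4 0)) (split (3 ∷ 1 ∷ []) (split (6 ∷ 5 ∷ 1 ∷ [])
  (mono 1 1 0) (split (10 ∷ 15 ∷ 7 ∷ 1 ∷ []) (split (7 ∷ 11 ∷ 6 ∷ 1 ∷ []) (mono 3 0 1)
  (split (3 ∷ 4 ∷ 1 ∷ []) (split (1 ∷ 1 ∷ []) (mono 12 0 1) (split (3 ∷ 2 ∷ [])
  (split (6 ∷ 6 ∷ 1 ∷ []) (mono 7 1 0) (split (6 ∷ 9 ∷ 5 ∷ 1 ∷ []) (mono 4 2 0) (mono 3 0 5)
  (split (5 ∷ 4 ∷ 1 ∷ []) (mono 16 9 0) (split (9 ∷ 13 ∷ 6 ∷ 1 ∷ []) (split (12 ∷ 17 ∷ 7 ∷ 1 ∷ [])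
  (mono 11 1 0) (mono 10 4 0) (mono 16 13 0)) (mono 1 16 0) (mono 15 14 0)) (mono 0 14 1)))
  (mono 12 8 0)) (mono 1 0 12) (mono 7 0 10)) (split (12 ∷ 18 ∷ 8 ∷ 1 ∷ []) (mono 13 4 0)
  (split (6 ∷ 11 ∷ 6 ∷ 1 ∷ []) (mono 3 3 0) (split (2 ∷ 3 ∷ 1 ∷ []) (split (8 ∷ 10 ∷ 3 ∷ [])
  (mono 1 0 7) (mono 15 0 3) (split (8 ∷ 6 ∷ 1 ∷ []) (mono 0 17 8) (mono 0 16 4)
  (split (13 ∷ 19 ∷ 8 ∷ 1 ∷ []) (mono 11 9 0) (split (7 ∷ 8 ∷ 2 ∷ []) (mono 8 0 10) (mono 11 0 1)
  (mono 7 0 3)) (mono 1 12 0)))) (mono 14 0 1) (mono 3 3 0)) (mono 8 2 0)) (mono 1 8 0)))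
  (mono 0 10 1) (mono 0 5 8)) (mono 8 0 7)) (mono 1 8 0) (mono 7 0 4)) (mono 0 2 3))
  (split (6 ∷ 5 ∷ 1 ∷ []) (split (4 ∷ 1 ∷ []) (split (6 ∷ 6 ∷ 1 ∷ []) (mono 1 10 0) (split (2 ∷ [])
  (mono 2 0 3) (mono 0 10 1) (split (3 ∷ 2 ∷ []) (split (9 ∷ 13 ∷ 6 ∷ 1 ∷ []) (mono 5 1 0)
  (split (12 ∷ 17 ∷ 7 ∷ 1 ∷ []) (split (3 ∷ 4 ∷ 1 ∷ []) (split (6 ∷ 9 ∷ 5 ∷ 1 ∷ []) (mono 1 4 0)
  (mono 9 0 3) (split (9 ∷ 10 ∷ 2 ∷ []) (mono 2 0 3) (mono 10 7 0) (split (7 ∷ 8 ∷ 2 ∷ [])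
  (split (5 ∷ 4 ∷ 1 ∷ []) (mono 0 1 5) (mono 0 18 6) (mono 0 17 3)) (mono 11 17 0) (mono 7 0 1))))
  (mono 0 5 2) (mono 0 9 12)) (mono 7 1 0) (mono 12 9 0)) (mono 11 10 0)) (mono 5 0 2)
  (mono 6 0 9))) (mono 8 4 0)) (mono 2 0 5) (mono 0 7 3)) (mono 1 1 0) (mono 0 2 3)) (mono 0 4 2))))
  (mono 0 2 1)))) (split (1 ∷ []) (mono 0 0 2) (split (8 ∷ 12 ∷ 6 ∷ 1 ∷ []) (split (6 ∷ 5 ∷ 1 ∷ [])
  (mono 0 4 1) (split (5 ∷ 5 ∷ 1 ∷ []) (split (3 ∷ 1 ∷ []) (mono 0 6 1) (mono 0 0 2)
  (split (7 ∷ 11 ∷ 6 ∷ 1 ∷ []) (mono 2 7 0) (mono 3 5 0) (split (10 ∷ 15 ∷ 7 ∷ 1 ∷ []) (mono 8 5 0)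
  (split (3 ∷ 4 ∷ 1 ∷ []) (mono 0 4 6) (split (7 ∷ 8 ∷ 2 ∷ []) (mono 10 5 0) (mono 1 0 2)
  (mono 4 9 0)) (mono 0 8 2)) (mono 2 1 0)))) (split (10 ∷ 15 ∷ 7 ∷ 1 ∷ []) (mono 6 3 0)
  (mono 1 1 0) (split (3 ∷ 3 ∷ 1 ∷ []) (split (5 ∷ 4 ∷ 1 ∷ []) (mono 0 1 5) (mono 6 0 4)
  (split (5 ∷ 6 ∷ 2 ∷ []) (mono 9 2 0) (split (6 ∷ 7 ∷ 2 ∷ []) (split (4 ∷ 2 ∷ []) (mono 0 11 1)
  (mono 0 9 2) (split (9 ∷ 13 ∷ 6 ∷ 1 ∷ []) (mono 5 2 0) (split (3 ∷ 2 ∷ []) (mono 0 0 3)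
  (mono 9 0 1) (split (7 ∷ 6 ∷ 1 ∷ []) (split (10 ∷ 16 ∷ 8 ∷ 1 ∷ []) (mono 1 8 0) (mono 10 6 0)
  (split (7 ∷ 11 ∷ 6 ∷ 1 ∷ []) (split (6 ∷ 10 ∷ 6 ∷ 1 ∷ []) (split (4 ∷ 5 ∷ 2 ∷ []) (mono 11 0 2)
  (mono 16 0 9) (split (8 ∷ 13 ∷ 7 ∷ 1 ∷ []) (mono 19 2 0) (split (9 ∷ 14 ∷ 7 ∷ 1 ∷ [])
  (mono 6 20 0) (mono 18 1 0) (mono 12 2 0)) (mono 18 1 0))) (mono 12 15 0) (mono 6 0 2))
  (mono 12 14 0) (mono 3 0 1))) (mono 12 10 0) (mono 0 1 8))) (mono 4 11 0))) (mono 8 1 0)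
  (mono 9 0 4)) (mono 1 0 3))) (split (2 ∷ []) (split (6 ∷ 10 ∷ 6 ∷ 1 ∷ []) (mono 1 0 6)
  (mono 4 7 0) (split (4 ∷ 1 ∷ []) (split (2 ∷ 2 ∷ 1 ∷ []) (split (6 ∷ 7 ∷ 2 ∷ []) (mono 2 1 0)
  (split (6 ∷ 6 ∷ 1 ∷ []) (mono 3 13 0) (mono 11 8 0) (split (12 ∷ 18 ∷ 8 ∷ 1 ∷ [])
  (split (10 ∷ 16 ∷ 8 ∷ 1 ∷ []) (mono 7 0 1) (split (8 ∷ 13 ∷ 7 ∷ 1 ∷ []) (mono 6 0 2) (mono 11 9 0)
  (split (4 ∷ 5 ∷ 2 ∷ []) (mono 17 6 0) (mono 13 0 2) (mono 16 0 1))) (mono 2 14 0)) (mono 10 2 0)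
  (mono 1 1 0))) (mono 11 0 6)) (mono 9 0 4) (mono 10 0 2)) (mono 0 8 5) (mono 0 1 4))) (mono 0 1 3)
  (split (6 ∷ 6 ∷ 1 ∷ []) (split (8 ∷ 13 ∷ 7 ∷ 1 ∷ []) (mono 1 10 0) (mono 5 3 0) (mono 2 0 4))
  (mono 7 4 0) (mono 1 8 0))) (split (6 ∷ 9 ∷ 5 ∷ 1 ∷ []) (mono 8 0 5) (split (7 ∷ 11 ∷ 6 ∷ 1 ∷ [])
  (split (5 ∷ 8 ∷ 5 ∷ 1 ∷ []) (mono 10 0 1) (mono 8 0 2) (split (7 ∷ 10 ∷ 5 ∷ 1 ∷ [])
  (split (1 ∷ 3 ∷ 1 ∷ []) (split (6 ∷ 6 ∷ 1 ∷ []) (mono 1 0 2) (mono 11 8 0) (split (6 ∷ 7 ∷ 2 ∷ [])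
  (mono 2 0 5) (split (5 ∷ 2 ∷ []) (split (12 ∷ 18 ∷ 8 ∷ 1 ∷ []) (mono 1 7 0) (mono 12 2 0)
  (mono 3 3 0)) (mono 0 13 1) (mono 0 5 9)) (mono 13 0 8))) (mono 0 7 4) (mono 0 11 2)) (mono 9 3 0)
  (mono 4 10 0))) (mono 5 7 0) (mono 8 2 0)) (mono 1 1 0)))) (split (10 ∷ 15 ∷ 7 ∷ 1 ∷ [])
  (mono 6 3 0) (split (9 ∷ 14 ∷ 7 ∷ 1 ∷ []) (split (7 ∷ 11 ∷ 6 ∷ 1 ∷ []) (mono 8 0 1) (mono 4 6 0)
  (split (7 ∷ 6 ∷ 1 ∷ []) (mono 0 9 2) (mono 7 5 0) (split (11 ∷ 17 ∷ 8 ∷ 1 ∷ []) (mono 10 3 0)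
  (split (12 ∷ 18 ∷ 8 ∷ 1 ∷ []) (split (1 ∷ 1 ∷ []) (mono 0 9 5) (mono 0 6 2)
  (split (5 ∷ 6 ∷ 2 ∷ []) (split (6 ∷ 9 ∷ 5 ∷ 1 ∷ []) (mono 14 0 11) (split (3 ∷ 3 ∷ 1 ∷ [])
  (mono 15 0 2) (mono 0 0 1) (split (3 ∷ 2 ∷ []) (mono 0 16 3) (split (9 ∷ 13 ∷ 6 ∷ 1 ∷ [])
  (split (11 ∷ 16 ∷ 7 ∷ 1 ∷ []) (mono 18 1 0) (mono 16 12 0) (split (7 ∷ 5 ∷ 1 ∷ []) (mono 0 6 8)
  (split (10 ∷ 14 ∷ 6 ∷ 1 ∷ []) (split (2 ∷ []) (mono 0 18 1) (mono 0 19 5) (mono 0 6 16))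
  (mono 1 4 0) (mono 8 0 2)) (mono 0 18 1))) (mono 13 1 0) (mono 16 12 0)) (mono 4 0 15)))
  (mono 2 0 6)) (mono 9 0 3) (mono 1 12 0))) (mono 9 1 0) (mono 2 6 0)) (mono 1 9 0)))) (mono 5 0 1)
  (mono 2 6 0)) (mono 1 1 0))) (split (10 ∷ 15 ∷ 7 ∷ 1 ∷ []) (mono 5 2 0) (split (5 ∷ 5 ∷ 1 ∷ [])
  (split (3 ∷ 1 ∷ []) (mono 0 7 1) (split (7 ∷ 11 ∷ 6 ∷ 1 ∷ []) (mono 2 8 0) (mono 1 0 3)
  (split (3 ∷ 4 ∷ 1 ∷ []) (mono 0 3 6) (split (7 ∷ 8 ∷ 2 ∷ []) (mono 10 4 0) (mono 1 0 5)
  (split (11 ∷ 16 ∷ 7 ∷ 1 ∷ []) (split (13 ∷ 19 ∷ 8 ∷ 1 ∷ []) (mono 12 1 0) (mono 5 7 0)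
  (mono 8 2 0)) (mono 9 6 0) (mono 10 1 0))) (mono 0 8 1))) (mono 0 0 3)) (mono 0 0 1)
  (split (9 ∷ 14 ∷ 7 ∷ 1 ∷ []) (split (11 ∷ 16 ∷ 7 ∷ 1 ∷ []) (split (3 ∷ 1 ∷ []) (mono 0 6 1)
  (split (2 ∷ []) (mono 0 3 2) (mono 8 0 1) (split (13 ∷ 19 ∷ 8 ∷ 1 ∷ []) (mono 11 3 0) (mono 2 6 0)
  (split (4 ∷ 2 ∷ []) (split (11 ∷ 17 ∷ 8 ∷ 1 ∷ []) (mono 13 6 0) (split (12 ∷ 18 ∷ 8 ∷ 1 ∷ [])
  (mono 2 11 0) (mono 12 1 0) (split (7 ∷ 6 ∷ 1 ∷ []) (mono 0 15 8) (split (8 ∷ 7 ∷ 1 ∷ [])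
  (split (4 ∷ 1 ∷ []) (mono 0 5 1) (mono 0 8 2) (mono 0 7 13)) (mono 14 1 0) (mono 6 12 0))
  (mono 0 9 1))) (mono 3 0 2)) (mono 10 3 0) (mono 2 2 0)))) (mono 0 0 5)) (mono 6 3 0)
  (mono 4 2 0)) (mono 5 0 2) (mono 1 6 0))) (mono 1 4 0))) (split (7 ∷ 5 ∷ 1 ∷ [])
  (split (9 ∷ 13 ∷ 6 ∷ 1 ∷ []) (mono 1 5 0) (mono 3 2 0) (split (3 ∷ 4 ∷ 1 ∷ []) (split (3 ∷ 2 ∷ [])
  (split (5 ∷ 5 ∷ 1 ∷ []) (mono 8 1 0) (split (1 ∷ 1 ∷ []) (mono 9 0 3) (split (6 ∷ 7 ∷ 2 ∷ [])
  (mono 3 3 0) (mono 1 2 0) (split (10 ∷ 15 ∷ 7 ∷ 1 ∷ []) (split (3 ∷ 3 ∷ 1 ∷ []) (mono 8 0 1)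
  (split (6 ∷ 9 ∷ 5 ∷ 1 ∷ []) (mono 7 6 0) (mono 1 1 0) (split (5 ∷ 4 ∷ 1 ∷ [])
  (split (8 ∷ 11 ∷ 5 ∷ 1 ∷ []) (mono 1 8 0) (mono 3 7 0) (split (2 ∷ []) (split (4 ∷ 3 ∷ [])
  (mono 1 17 0) (mono 8 0 9) (mono 16 0 2)) (mono 0 4 8) (mono 0 3 1))) (mono 0 2 11)
  (mono 0 13 9))) (mono 0 2 7)) (mono 3 3 0) (mono 10 1 0))) (split (5 ∷ 6 ∷ 2 ∷ []) (mono 3 10 0)
  (split (10 ∷ 15 ∷ 7 ∷ 1 ∷ []) (split (6 ∷ 7 ∷ 2 ∷ []) (mono 5 5 0) (mono 10 2 0)
  (split (3 ∷ 3 ∷ 1 ∷ []) (mono 9 0 2) (mono 0 3 10) (mono 0 1 8))) (mono 3 3 0) (mono 2 6 0))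
  (mono 1 9 0))) (mono 7 0 3)) (split (5 ∷ 5 ∷ 1 ∷ []) (split (7 ∷ 11 ∷ 6 ∷ 1 ∷ []) (mono 1 9 0)
  (mono 7 0 6) (split (2 ∷ []) (split (4 ∷ 3 ∷ []) (mono 1 11 0) (mono 9 4 0)
  (split (3 ∷ 3 ∷ 1 ∷ []) (mono 2 0 4) (split (5 ∷ 4 ∷ 1 ∷ []) (split (1 ∷ 1 ∷ []) (mono 14 0 8)
  (split (7 ∷ 10 ∷ 5 ∷ 1 ∷ []) (mono 2 15 0) (mono 1 0 12) (split (11 ∷ 17 ∷ 8 ∷ 1 ∷ [])
  (split (8 ∷ 10 ∷ 3 ∷ []) (mono 11 0 1) (split (6 ∷ 7 ∷ 2 ∷ []) (mono 10 0 2) (mono 11 11 0)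
  (split (4 ∷ 5 ∷ 2 ∷ []) (mono 15 0 3) (mono 12 17 0) (split (5 ∷ 3 ∷ 1 ∷ []) (mono 10 0 16)
  (split (8 ∷ 11 ∷ 5 ∷ 1 ∷ []) (split (6 ∷ 4 ∷ 1 ∷ []) (mono 0 22 1) (mono 20 2 0)
  (split (12 ∷ 17 ∷ 7 ∷ 1 ∷ []) (mono 19 15 0) (split (4 ∷ 3 ∷ 1 ∷ []) (mono 24 14 0) (mono 0 7 1)
  (split (10 ∷ 13 ∷ 6 ∷ 1 ∷ []) (mono 12 12 0) (split (7 ∷ 7 ∷ 2 ∷ []) (mono 26 13 0) (mono 14 0 1)
  (split (3 ∷ 1 ∷ []) (mono 0 27 19) (split (11 ∷ 15 ∷ 7 ∷ 1 ∷ []) (split (13 ∷ 18 ∷ 8 ∷ 1 ∷ [])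
  (mono 29 1 0) (mono 22 4 0) (split (6 ∷ 5 ∷ 1 ∷ []) (mono 22 0 2) (mono 3 3 0) (mono 0 4 1)))
  (mono 14 3 0) (mono 27 2 0)) (mono 0 3 1))) (mono 3 1 0))) (mono 1 5 0))) (mono 1 9 0)
  (mono 20 10 0)) (mono 0 1 15)))) (mono 6 6 0)) (mono 9 13 0) (mono 5 1 0)))
  (split (10 ∷ 15 ∷ 7 ∷ 1 ∷ []) (mono 7 7 0) (split (7 ∷ 6 ∷ 1 ∷ []) (mono 6 3 0) (mono 0 9 1)
  (split (11 ∷ 17 ∷ 8 ∷ 1 ∷ []) (split (9 ∷ 14 ∷ 7 ∷ 1 ∷ []) (mono 18 0 1) (mono 16 0 3)
  (split (4 ∷ 5 ∷ 2 ∷ []) (mono 15 0 2) (mono 12 17 0) (split (5 ∷ 3 ∷ 1 ∷ []) (mono 10 0 16)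
  (split (5 ∷ 7 ∷ 3 ∷ []) (split (3 ∷ 4 ∷ 2 ∷ []) (mono 22 0 1) (mono 2 0 19)
  (split (6 ∷ 4 ∷ 1 ∷ []) (mono 0 2 6) (mono 21 3 0) (mono 0 1 5))) (mono 1 0 6) (mono 7 2 0))
  (mono 0 1 15)))) (mono 10 14 0) (mono 1 16 0))) (mono 1 10 0))) (mono 0 1 10) (mono 0 12 8))
  (mono 11 0 3))) (mono 0 8 3) (mono 0 1 5))) (mono 0 1 5) (mono 7 0 3)) (split (1 ∷ 1 ∷ [])
  (mono 8 0 2) (split (7 ∷ 10 ∷ 5 ∷ 1 ∷ []) (split (5 ∷ 4 ∷ 1 ∷ []) (mono 0 10 1)
  (split (6 ∷ 5 ∷ 1 ∷ []) (split (4 ∷ 2 ∷ []) (mono 12 0 1) (mono 4 0 2) (split (5 ∷ 7 ∷ 4 ∷ 1 ∷ [])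
  (mono 13 0 4) (split (6 ∷ 8 ∷ 4 ∷ 1 ∷ []) (split (4 ∷ 3 ∷ 1 ∷ []) (mono 0 15 1) (mono 13 0 5)
  (split (8 ∷ 11 ∷ 5 ∷ 1 ∷ []) (mono 16 2 0) (split (3 ∷ 1 ∷ []) (mono 0 0 6) (mono 0 4 1)
  (split (6 ∷ 6 ∷ 2 ∷ []) (split (8 ∷ 9 ∷ 3 ∷ []) (mono 19 1 0) (split (7 ∷ 7 ∷ 2 ∷ [])
  (split (13 ∷ 18 ∷ 8 ∷ 1 ∷ []) (mono 17 3 0) (mono 11 2 0) (split (9 ∷ 10 ∷ 3 ∷ []) (mono 22 2 0)
  (mono 20 3 0) (mono 21 0 1))) (mono 12 0 1) (mono 13 8 0)) (mono 7 4 0)) (mono 10 8 0)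
  (mono 11 1 0))) (mono 1 15 0))) (mono 12 1 0) (mono 7 0 9)) (mono 1 0 8))) (mono 9 1 0)
  (mono 0 4 6)) (mono 0 9 5)) (mono 1 0 6) (mono 8 2 0)) (mono 0 1 7))) (split (5 ∷ 5 ∷ 1 ∷ [])
  (split (7 ∷ 8 ∷ 2 ∷ []) (mono 8 1 0) (split (10 ∷ 15 ∷ 7 ∷ 1 ∷ []) (mono 2 2 0) (mono 3 1 0)
  (split (6 ∷ 7 ∷ 2 ∷ []) (split (1 ∷ 1 ∷ []) (mono 0 4 1) (split (8 ∷ 10 ∷ 3 ∷ []) (mono 12 2 0)
  (mono 1 4 0) (split (4 ∷ 2 ∷ []) (mono 0 13 3) (split (2 ∷ 3 ∷ 1 ∷ [])
  (split (7 ∷ 10 ∷ 5 ∷ 1 ∷ []) (mono 1 8 0) (mono 4 0 12) (split (3 ∷ 2 ∷ []) (mono 16 0 9)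
  (mono 3 0 8) (mono 0 1 7))) (mono 12 0 8) (mono 0 2 5)) (mono 0 12 1))) (mono 0 6 2)) (mono 8 0 2)
  (mono 9 0 1))) (split (3 ∷ 1 ∷ []) (mono 0 9 2) (split (11 ∷ 16 ∷ 7 ∷ 1 ∷ [])
  (split (6 ∷ 5 ∷ 1 ∷ []) (mono 0 4 1) (mono 2 2 0) (split (10 ∷ 15 ∷ 7 ∷ 1 ∷ []) (mono 5 5 0)
  (split (13 ∷ 19 ∷ 8 ∷ 1 ∷ []) (mono 13 3 0) (mono 4 1 0) (mono 2 5 0)) (mono 1 11 0)))
  (mono 1 7 0) (mono 9 2 0)) (mono 0 8 1))) (mono 1 0 4) (mono 6 0 2)) (split (7 ∷ 11 ∷ 6 ∷ 1 ∷ [])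
  (split (5 ∷ 5 ∷ 1 ∷ []) (mono 0 8 1) (split (6 ∷ 6 ∷ 1 ∷ []) (split (4 ∷ 1 ∷ []) (mono 0 10 1)
  (mono 0 8 2) (split (8 ∷ 9 ∷ 2 ∷ []) (mono 11 2 0) (split (5 ∷ 8 ∷ 5 ∷ 1 ∷ []) (mono 12 0 5)
  (split (13 ∷ 18 ∷ 7 ∷ 1 ∷ []) (mono 9 4 0) (split (5 ∷ 4 ∷ 1 ∷ []) (split (3 ∷ 1 ∷ [])
  (mono 15 0 1) (mono 0 3 12) (split (12 ∷ 17 ∷ 7 ∷ 1 ∷ []) (split (7 ∷ 8 ∷ 2 ∷ []) (mono 3 0 1)
  (split (6 ∷ 5 ∷ 1 ∷ []) (mono 0 9 2) (split (14 ∷ 20 ∷ 8 ∷ 1 ∷ []) (mono 19 3 0) (mono 1 8 0)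
  (split (11 ∷ 16 ∷ 7 ∷ 1 ∷ []) (split (5 ∷ 2 ∷ []) (mono 21 0 17) (split (10 ∷ 12 ∷ 3 ∷ [])
  (split (12 ∷ 15 ∷ 4 ∷ []) (mono 23 1 0) (mono 2 6 0) (split (2 ∷ 3 ∷ 1 ∷ []) (mono 0 2 8)
  (split (11 ∷ 13 ∷ 3 ∷ []) (split (13 ∷ 16 ∷ 4 ∷ []) (mono 26 1 0) (mono 5 15 0)
  (split (1 ∷ 3 ∷ 1 ∷ []) (mono 0 5 7) (mono 0 10 24) (mono 0 1 8))) (mono 1 0 12) (mono 19 0 6))
  (mono 0 1 5))) (mono 1 14 0) (mono 21 0 3)) (mono 0 16 2)) (mono 2 12 0) (mono 5 0 1)))
  (mono 3 3 0)) (mono 2 16 0)) (mono 14 0 3) (mono 1 11 0))) (mono 0 3 1) (mono 0 13 9))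
  (mono 3 8 0)) (mono 2 0 7)) (mono 1 10 0))) (mono 7 1 0) (mono 3 0 4)) (mono 7 0 3)) (mono 5 0 4)
  (mono 1 6 0)))) (mono 0 2 1) (split (11 ∷ 16 ∷ 7 ∷ 1 ∷ []) (split (9 ∷ 13 ∷ 6 ∷ 1 ∷ [])
  (mono 6 0 1) (mono 4 3 0) (split (7 ∷ 11 ∷ 6 ∷ 1 ∷ []) (split (5 ∷ 5 ∷ 1 ∷ []) (mono 0 8 1)
  (split (4 ∷ 1 ∷ []) (mono 0 2 4) (mono 0 7 1) (split (5 ∷ 8 ∷ 5 ∷ 1 ∷ []) (mono 10 0 3)
  (split (3 ∷ 1 ∷ []) (split (5 ∷ 4 ∷ 1 ∷ []) (mono 12 1 0) (split (10 ∷ 15 ∷ 7 ∷ 1 ∷ [])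
  (mono 2 6 0) (mono 5 5 0) (split (6 ∷ 5 ∷ 1 ∷ []) (mono 3 3 0) (mono 12 2 0) (mono 0 13 1)))
  (mono 0 11 6)) (mono 0 1 8) (mono 0 2 7)) (mono 1 0 4))) (mono 7 0 2)) (mono 5 0 4)
  (split (3 ∷ 2 ∷ []) (split (5 ∷ 5 ∷ 1 ∷ []) (mono 9 1 0) (split (3 ∷ 4 ∷ 1 ∷ [])
  (split (1 ∷ 1 ∷ []) (mono 11 0 1) (split (6 ∷ 7 ∷ 2 ∷ []) (mono 4 4 0) (mono 1 3 0)
  (split (10 ∷ 15 ∷ 7 ∷ 1 ∷ []) (split (13 ∷ 19 ∷ 8 ∷ 1 ∷ []) (mono 14 9 0) (split (8 ∷ 6 ∷ 1 ∷ [])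
  (mono 0 7 10) (mono 0 6 1) (split (12 ∷ 18 ∷ 8 ∷ 1 ∷ []) (mono 16 3 0) (mono 14 0 2)
  (mono 1 15 0))) (mono 10 2 0)) (mono 4 4 0) (mono 12 1 0))) (split (6 ∷ 9 ∷ 5 ∷ 1 ∷ [])
  (mono 2 4 0) (split (8 ∷ 11 ∷ 5 ∷ 1 ∷ []) (mono 5 0 8) (split (3 ∷ 3 ∷ 1 ∷ [])
  (split (6 ∷ 10 ∷ 6 ∷ 1 ∷ []) (mono 5 1 0) (mono 6 13 0) (split (5 ∷ 8 ∷ 5 ∷ 1 ∷ []) (mono 6 16 0)
  (mono 14 0 4) (mono 5 0 1))) (mono 0 5 1) (mono 13 0 7)) (mono 2 0 7)) (mono 1 0 5))) (mono 0 1 7)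
  (mono 0 9 3)) (mono 8 0 3)) (split (2 ∷ []) (split (5 ∷ 5 ∷ 1 ∷ []) (split (3 ∷ 3 ∷ 1 ∷ [])
  (mono 2 0 1) (split (5 ∷ 4 ∷ 1 ∷ []) (split (6 ∷ 7 ∷ 2 ∷ []) (mono 1 0 8) (mono 5 5 0)
  (split (13 ∷ 19 ∷ 8 ∷ 1 ∷ []) (mono 14 9 0) (split (10 ∷ 14 ∷ 6 ∷ 1 ∷ []) (mono 3 5 0)
  (mono 7 0 1) (split (6 ∷ 6 ∷ 1 ∷ []) (mono 6 0 11) (split (7 ∷ 7 ∷ 1 ∷ []) (mono 8 7 0)
  (mono 15 1 0) (split (3 ∷ []) (split (7 ∷ 6 ∷ 1 ∷ []) (mono 10 7 0) (mono 0 3 5)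
  (split (11 ∷ 17 ∷ 8 ∷ 1 ∷ []) (split (14 ∷ 20 ∷ 8 ∷ 1 ∷ []) (mono 3 1 0) (mono 19 7 0)
  (mono 2 4 0)) (mono 12 17 0) (mono 1 19 0))) (mono 0 7 2) (mono 0 11 3))) (mono 15 0 1)))
  (mono 10 1 0))) (mono 0 1 9) (mono 0 11 6)) (mono 10 0 4)) (mono 0 2 7) (mono 9 0 4)) (mono 0 7 1)
  (mono 0 2 3)) (split (1 ∷ 1 ∷ []) (split (12 ∷ 18 ∷ 8 ∷ 1 ∷ []) (mono 1 5 0)
  (split (3 ∷ 4 ∷ 1 ∷ []) (mono 11 2 0) (split (5 ∷ 5 ∷ 1 ∷ []) (split (6 ∷ 7 ∷ 2 ∷ []) (mono 4 1 0)
  (split (6 ∷ 5 ∷ 1 ∷ []) (mono 0 2 9) (mono 0 1 4) (mono 0 6 8)) (mono 5 5 0)) (mono 1 0 9)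
  (mono 11 0 6)) (mono 0 10 4)) (mono 2 4 0)) (split (7 ∷ 10 ∷ 5 ∷ 1 ∷ []) (split (5 ∷ 4 ∷ 1 ∷ [])
  (mono 0 11 1) (split (6 ∷ 5 ∷ 1 ∷ []) (split (3 ∷ 3 ∷ 1 ∷ []) (split (6 ∷ 9 ∷ 5 ∷ 1 ∷ [])
  (mono 1 1 0) (mono 3 12 0) (split (9 ∷ 14 ∷ 7 ∷ 1 ∷ []) (mono 3 2 0) (mono 6 12 0) (mono 7 1 0)))
  (mono 2 0 10) (mono 12 0 6)) (mono 10 1 0) (mono 0 4 6)) (mono 0 10 5)) (mono 1 0 7) (mono 9 2 0))
  (mono 0 1 8))))) (split (5 ∷ 5 ∷ 1 ∷ []) (split (3 ∷ 1 ∷ []) (mono 0 7 1) (mono 0 4 2)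
  (split (7 ∷ 11 ∷ 6 ∷ 1 ∷ []) (mono 2 8 0) (mono 6 0 5) (split (10 ∷ 15 ∷ 7 ∷ 1 ∷ []) (mono 3 3 0)
  (mono 7 0 4) (mono 2 1 0)))) (split (3 ∷ 1 ∷ []) (split (6 ∷ 5 ∷ 1 ∷ []) (mono 1 1 0) (mono 0 2 3)
  (split (10 ∷ 15 ∷ 7 ∷ 1 ∷ []) (split (7 ∷ 11 ∷ 6 ∷ 1 ∷ []) (mono 3 0 1) (mono 8 0 7)
  (split (3 ∷ 4 ∷ 1 ∷ []) (split (1 ∷ 1 ∷ []) (mono 12 0 1) (split (12 ∷ 18 ∷ 8 ∷ 1 ∷ [])
  (mono 13 4 0) (mono 1 8 0) (split (6 ∷ 11 ∷ 6 ∷ 1 ∷ []) (mono 3 3 0) (mono 8 2 0)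
  (split (2 ∷ 3 ∷ 1 ∷ []) (split (8 ∷ 10 ∷ 3 ∷ []) (mono 1 0 7) (split (8 ∷ 6 ∷ 1 ∷ [])
  (mono 0 17 8) (split (13 ∷ 19 ∷ 8 ∷ 1 ∷ []) (mono 11 9 0) (mono 1 12 0) (split (7 ∷ 8 ∷ 2 ∷ [])
  (mono 8 0 10) (mono 7 0 3) (mono 11 0 1))) (mono 0 16 4)) (mono 15 0 3)) (mono 3 3 0)
  (mono 14 0 1)))) (split (3 ∷ 2 ∷ []) (split (6 ∷ 6 ∷ 1 ∷ []) (mono 7 1 0) (mono 12 8 0)
  (split (6 ∷ 9 ∷ 5 ∷ 1 ∷ []) (mono 4 2 0) (split (5 ∷ 4 ∷ 1 ∷ []) (mono 16 9 0) (mono 0 14 1)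
  (split (9 ∷ 13 ∷ 6 ∷ 1 ∷ []) (split (12 ∷ 17 ∷ 7 ∷ 1 ∷ []) (mono 11 1 0) (mono 16 13 0)
  (mono 10 4 0)) (mono 15 14 0) (mono 1 16 0))) (mono 3 0 5))) (mono 7 0 10) (mono 1 0 12)))
  (mono 0 5 8) (mono 0 10 1))) (mono 7 0 4) (mono 1 8 0))) (mono 0 4 2) (split (6 ∷ 5 ∷ 1 ∷ [])
  (split (4 ∷ 1 ∷ []) (split (6 ∷ 6 ∷ 1 ∷ []) (mono 1 10 0) (mono 8 4 0) (split (2 ∷ [])
  (mono 2 0 3) (split (3 ∷ 2 ∷ []) (split (9 ∷ 13 ∷ 6 ∷ 1 ∷ []) (mono 5 1 0) (mono 11 10 0)
  (split (12 ∷ 17 ∷ 7 ∷ 1 ∷ []) (split (3 ∷ 4 ∷ 1 ∷ []) (split (6 ∷ 9 ∷ 5 ∷ 1 ∷ []) (mono 1 4 0)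
  (split (9 ∷ 10 ∷ 2 ∷ []) (mono 2 0 3) (split (7 ∷ 8 ∷ 2 ∷ []) (split (5 ∷ 4 ∷ 1 ∷ []) (mono 0 1 5)
  (mono 0 17 3) (mono 0 18 6)) (mono 7 0 1) (mono 11 17 0)) (mono 10 7 0)) (mono 9 0 3))
  (mono 0 9 12) (mono 0 5 2)) (mono 12 9 0) (mono 7 1 0))) (mono 6 0 9) (mono 5 0 2))
  (mono 0 10 1))) (mono 0 7 3) (mono 2 0 5)) (mono 0 2 3) (mono 1 1 0)))
  (split (9 ∷ 13 ∷ 6 ∷ 1 ∷ []) (split (10 ∷ 15 ∷ 7 ∷ 1 ∷ []) (split (12 ∷ 17 ∷ 7 ∷ 1 ∷ [])
  (split (3 ∷ 1 ∷ []) (mono 0 3 1) (mono 0 7 5) (split (3 ∷ 2 ∷ []) (split (6 ∷ 5 ∷ 1 ∷ [])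
  (mono 0 1 5) (split (7 ∷ 6 ∷ 1 ∷ []) (mono 0 2 5) (mono 11 1 0) (split (12 ∷ 18 ∷ 8 ∷ 1 ∷ [])
  (mono 14 6 0) (split (1 ∷ 1 ∷ []) (mono 0 8 7) (mono 0 10 1) (split (6 ∷ 7 ∷ 2 ∷ []) (mono 5 5 0)
  (mono 4 0 2) (mono 1 10 0))) (mono 1 8 0))) (mono 2 2 0)) (split (2 ∷ []) (mono 0 4 3)
  (mono 0 10 1) (split (8 ∷ 6 ∷ 1 ∷ []) (mono 0 13 5) (mono 0 2 8) (split (12 ∷ 18 ∷ 8 ∷ 1 ∷ [])
  (mono 14 6 0) (split (1 ∷ 1 ∷ []) (mono 0 8 7) (mono 0 10 1) (split (4 ∷ 3 ∷ [])
  (split (6 ∷ 7 ∷ 2 ∷ []) (split (6 ∷ 4 ∷ 1 ∷ []) (mono 0 1 9) (split (7 ∷ 10 ∷ 5 ∷ 1 ∷ [])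
  (mono 19 0 12) (mono 1 17 0) (split (5 ∷ 6 ∷ 2 ∷ []) (split (4 ∷ 3 ∷ 1 ∷ []) (mono 0 1 14)
  (split (3 ∷ 2 ∷ 1 ∷ []) (split (5 ∷ 4 ∷ 1 ∷ []) (mono 0 3 15) (mono 21 2 0)
  (split (10 ∷ 13 ∷ 6 ∷ 1 ∷ []) (split (7 ∷ 8 ∷ 3 ∷ []) (mono 3 0 1) (mono 14 4 0)
  (split (2 ∷ 2 ∷ []) (mono 0 10 9) (split (10 ∷ 14 ∷ 6 ∷ 1 ∷ []) (mono 27 0 18) (mono 1 0 13)
  (mono 17 8 0)) (mono 0 3 1))) (mono 6 3 0) (mono 20 14 0))) (mono 20 0 1) (mono 7 10 0))
  (mono 6 11 0)) (mono 2 0 15) (mono 5 19 0))) (mono 6 0 5)) (mono 6 6 0) (mono 2 11 0))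
  (mono 14 5 0) (mono 1 0 10))) (mono 1 13 0)))) (split (1 ∷ 1 ∷ []) (mono 0 5 4)
  (split (10 ∷ 14 ∷ 6 ∷ 1 ∷ []) (mono 13 0 4) (mono 1 0 8) (mono 9 2 0)) (mono 0 1 11))))
  (mono 7 4 0) (mono 5 3 0)) (mono 6 0 3) (mono 2 2 0)) (mono 5 4 0) (mono 6 1 0))) (mono 1 4 0)))
  (mono 2 2 0)) (split (10 ∷ 15 ∷ 7 ∷ 1 ∷ []) (split (8 ∷ 12 ∷ 6 ∷ 1 ∷ []) (mono 4 0 1)
  (split (5 ∷ 5 ∷ 1 ∷ []) (mono 0 0 2) (split (3 ∷ 1 ∷ []) (split (6 ∷ 6 ∷ 1 ∷ [])
  (split (3 ∷ 2 ∷ []) (mono 2 0 1) (mono 3 0 4) (split (4 ∷ 3 ∷ []) (mono 9 0 2) (split (1 ∷ 1 ∷ [])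
  (split (4 ∷ 5 ∷ 1 ∷ []) (mono 0 4 8) (mono 0 2 7) (split (8 ∷ 13 ∷ 7 ∷ 1 ∷ []) (mono 5 12 0)
  (split (3 ∷ 3 ∷ 1 ∷ []) (mono 3 13 0) (mono 8 0 1) (mono 11 0 12)) (mono 1 11 0))) (mono 0 1 5)
  (mono 0 2 9)) (mono 7 1 0))) (split (12 ∷ 18 ∷ 8 ∷ 1 ∷ []) (mono 8 5 0) (mono 1 1 0)
  (split (13 ∷ 19 ∷ 8 ∷ 1 ∷ []) (mono 3 6 0) (split (8 ∷ 6 ∷ 1 ∷ []) (mono 0 10 7) (mono 0 5 1)
  (mono 0 9 2)) (mono 7 1 0))) (split (12 ∷ 18 ∷ 8 ∷ 1 ∷ []) (mono 8 5 0) (split (5 ∷ 6 ∷ 2 ∷ [])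
  (split (3 ∷ 3 ∷ 1 ∷ []) (mono 10 0 1) (split (3 ∷ 2 ∷ []) (mono 0 11 2) (mono 6 0 7)
  (split (7 ∷ 9 ∷ 3 ∷ []) (mono 12 3 0) (split (5 ∷ 4 ∷ 1 ∷ []) (mono 13 7 0) (mono 0 1 5)
  (split (6 ∷ 5 ∷ 1 ∷ []) (mono 8 8 0) (split (9 ∷ 14 ∷ 7 ∷ 1 ∷ []) (split (6 ∷ 7 ∷ 2 ∷ [])
  (split (3 ∷ 4 ∷ 1 ∷ []) (mono 0 1 2) (mono 0 12 13) (split (7 ∷ 11 ∷ 6 ∷ 1 ∷ []) (mono 12 0 15)
  (split (4 ∷ 5 ∷ 2 ∷ []) (split (2 ∷ []) (mono 0 1 4) (split (2 ∷ 2 ∷ []) (mono 0 21 2)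
  (mono 0 16 9) (split (6 ∷ 8 ∷ 3 ∷ []) (mono 22 3 0) (split (8 ∷ 10 ∷ 3 ∷ []) (mono 17 14 0)
  (mono 3 1 0) (mono 2 16 0)) (mono 1 21 0))) (mono 0 19 13)) (mono 9 0 1) (mono 8 17 0))
  (mono 1 17 0))) (mono 2 0 8) (mono 5 5 0)) (mono 1 5 0) (mono 8 4 0)) (mono 12 1 0)))
  (mono 1 11 0))) (mono 8 0 9)) (split (3 ∷ 3 ∷ 1 ∷ []) (split (10 ∷ 16 ∷ 8 ∷ 1 ∷ [])
  (split (7 ∷ 6 ∷ 1 ∷ []) (mono 0 2 1) (mono 0 7 4) (split (13 ∷ 19 ∷ 8 ∷ 1 ∷ []) (mono 7 10 0)
  (split (8 ∷ 6 ∷ 1 ∷ []) (mono 0 14 11) (mono 0 9 1) (split (7 ∷ 5 ∷ 1 ∷ []) (mono 0 5 12)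
  (mono 0 6 7) (mono 13 0 1))) (mono 1 6 0))) (mono 6 2 0) (mono 4 10 0)) (mono 0 1 6) (mono 8 0 9))
  (split (4 ∷ 2 ∷ []) (split (7 ∷ 6 ∷ 1 ∷ []) (mono 5 1 0) (mono 0 6 3) (split (6 ∷ 7 ∷ 2 ∷ [])
  (mono 2 12 0) (split (6 ∷ 5 ∷ 1 ∷ []) (mono 7 7 0) (mono 0 1 5) (mono 11 0 2)) (mono 10 3 0)))
  (mono 0 6 2) (mono 0 8 1))) (mono 1 1 0))) (split (5 ∷ 8 ∷ 5 ∷ 1 ∷ []) (split (3 ∷ 4 ∷ 1 ∷ [])
  (mono 0 8 1) (mono 0 3 4) (split (7 ∷ 11 ∷ 6 ∷ 1 ∷ []) (mono 9 2 0) (split (4 ∷ 7 ∷ 5 ∷ 1 ∷ [])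
  (split (2 ∷ 4 ∷ 1 ∷ []) (mono 0 11 1) (mono 0 6 2) (split (6 ∷ 10 ∷ 6 ∷ 1 ∷ []) (mono 12 2 0)
  (split (3 ∷ 6 ∷ 5 ∷ 1 ∷ []) (split (2 ∷ []) (mono 0 1 7) (mono 0 2 10) (split (1 ∷ 4 ∷ 1 ∷ [])
  (mono 0 15 2) (mono 0 10 3) (split (5 ∷ 9 ∷ 6 ∷ 1 ∷ []) (mono 16 3 0) (split (2 ∷ 5 ∷ 5 ∷ 1 ∷ [])
  (split (3 ∷ []) (mono 0 1 11) (mono 0 2 14) (split (5 ∷ 2 ∷ []) (mono 0 12 16)
  (split (8 ∷ 6 ∷ 1 ∷ []) (mono 0 20 17) (mono 14 1 0) (split (12 ∷ 18 ∷ 8 ∷ 1 ∷ []) (mono 21 18 0)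
  (mono 2 12 0) (mono 1 20 0))) (mono 5 1 0))) (mono 11 0 1) (mono 2 15 0)) (mono 1 15 0))))
  (mono 7 0 1) (mono 2 11 0)) (mono 1 11 0))) (mono 4 0 1) (mono 2 8 0)) (mono 1 8 0))) (mono 1 0 3)
  (mono 6 5 0)) (mono 0 4 5)) (mono 3 4 0)) (mono 3 3 0)) (split (5 ∷ 5 ∷ 1 ∷ [])
  (split (3 ∷ 1 ∷ []) (mono 0 5 1) (split (7 ∷ 11 ∷ 6 ∷ 1 ∷ []) (mono 2 6 0) (mono 1 0 3)
  (split (6 ∷ 5 ∷ 1 ∷ []) (split (8 ∷ 12 ∷ 6 ∷ 1 ∷ []) (mono 1 8 0) (split (5 ∷ 8 ∷ 5 ∷ 1 ∷ [])
  (split (11 ∷ 16 ∷ 7 ∷ 1 ∷ []) (mono 3 6 0) (mono 5 2 0) (split (7 ∷ 8 ∷ 2 ∷ []) (mono 11 7 0)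
  (split (3 ∷ 4 ∷ 1 ∷ []) (mono 0 12 3) (mono 0 1 9) (mono 0 11 6)) (mono 10 0 1))) (mono 4 0 1)
  (mono 8 7 0)) (mono 7 7 0)) (mono 2 2 0) (mono 0 5 1))) (mono 0 3 4)) (mono 0 0 1) (mono 2 3 0))
  (split (3 ∷ 1 ∷ []) (split (5 ∷ 5 ∷ 1 ∷ []) (mono 1 5 0) (split (6 ∷ 5 ∷ 1 ∷ []) (mono 2 2 0)
  (split (11 ∷ 16 ∷ 7 ∷ 1 ∷ []) (split (8 ∷ 12 ∷ 6 ∷ 1 ∷ []) (mono 4 0 1)
  (split (6 ∷ 9 ∷ 5 ∷ 1 ∷ []) (split (3 ∷ 3 ∷ 1 ∷ []) (mono 0 0 1) (split (9 ∷ 14 ∷ 7 ∷ 1 ∷ [])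
  (split (2 ∷ []) (mono 0 1 5) (mono 0 2 7) (split (3 ∷ 2 ∷ []) (mono 0 4 2) (mono 8 0 5)
  (mono 1 11 0))) (mono 5 1 0) (mono 9 0 8)) (mono 8 0 9)) (split (3 ∷ 3 ∷ 1 ∷ [])
  (split (6 ∷ 7 ∷ 2 ∷ []) (mono 7 1 0) (split (1 ∷ 1 ∷ []) (mono 0 12 2) (mono 0 7 1)
  (split (2 ∷ 3 ∷ 1 ∷ []) (split (3 ∷ 2 ∷ []) (split (9 ∷ 13 ∷ 6 ∷ 1 ∷ []) (mono 15 0 8)
  (split (11 ∷ 17 ∷ 8 ∷ 1 ∷ []) (split (9 ∷ 14 ∷ 7 ∷ 1 ∷ []) (mono 17 0 1)
  (split (5 ∷ 8 ∷ 5 ∷ 1 ∷ []) (mono 5 8 0) (split (7 ∷ 5 ∷ 1 ∷ []) (split (4 ∷ 1 ∷ []) (mono 16 0 1)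
  (mono 0 2 5) (split (5 ∷ 2 ∷ []) (mono 21 0 2) (split (14 ∷ 20 ∷ 8 ∷ 1 ∷ []) (mono 18 15 0)
  (mono 1 7 0) (mono 2 19 0)) (mono 19 1 0))) (split (13 ∷ 19 ∷ 8 ∷ 1 ∷ []) (mono 20 13 0)
  (mono 1 9 0) (split (14 ∷ 20 ∷ 8 ∷ 1 ∷ []) (mono 17 14 0) (split (9 ∷ 11 ∷ 3 ∷ []) (mono 9 0 15)
  (split (5 ∷ 4 ∷ 1 ∷ []) (mono 23 19 0) (mono 0 1 2) (split (4 ∷ 2 ∷ []) (split (7 ∷ 8 ∷ 2 ∷ [])
  (mono 1 11 0) (mono 6 0 4) (split (8 ∷ 9 ∷ 2 ∷ []) (split (3 ∷ 4 ∷ 1 ∷ []) (mono 0 1 20)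
  (mono 0 22 19) (mono 0 2 24)) (mono 20 0 5) (mono 24 1 0))) (mono 0 6 7) (mono 12 0 1)))
  (mono 21 0 2)) (mono 19 1 0))) (split (8 ∷ 6 ∷ 1 ∷ []) (mono 0 10 4) (split (13 ∷ 19 ∷ 8 ∷ 1 ∷ [])
  (mono 21 14 0) (mono 1 16 0) (split (14 ∷ 20 ∷ 8 ∷ 1 ∷ []) (mono 18 15 0) (split (9 ∷ 11 ∷ 3 ∷ [])
  (mono 10 0 16) (split (5 ∷ 4 ∷ 1 ∷ []) (mono 24 20 0) (mono 0 1 2) (split (8 ∷ 10 ∷ 3 ∷ [])
  (mono 15 0 18) (split (6 ∷ 4 ∷ 1 ∷ []) (split (8 ∷ 13 ∷ 6 ∷ 1 ∷ []) (mono 1 14 0)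
  (split (2 ∷ 2 ∷ []) (split (4 ∷ 5 ∷ 1 ∷ []) (mono 29 1 0) (mono 0 24 12) (split (6 ∷ 6 ∷ 1 ∷ [])
  (mono 26 16 0) (mono 10 0 8) (mono 1 0 27))) (mono 22 0 1) (mono 26 16 0)) (mono 8 15 0))
  (mono 0 1 4) (mono 24 0 7)) (mono 1 0 4))) (mono 22 0 2)) (mono 20 1 0))) (mono 18 1 0)))
  (mono 17 16 0)) (mono 15 0 14)) (mono 11 5 0) (mono 4 13 0)) (mono 3 0 12)) (mono 9 0 6)
  (mono 2 0 13)) (mono 0 2 5) (mono 1 1 0))) (mono 10 0 8)) (mono 0 0 1) (mono 8 0 9))
  (split (5 ∷ 4 ∷ 1 ∷ []) (mono 10 6 0) (split (3 ∷ 3 ∷ 1 ∷ []) (split (6 ∷ 7 ∷ 2 ∷ []) (mono 8 1 0)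
  (split (1 ∷ 1 ∷ []) (mono 0 13 2) (mono 0 8 1) (split (2 ∷ 3 ∷ 1 ∷ []) (split (5 ∷ 8 ∷ 5 ∷ 1 ∷ [])
  (mono 1 4 0) (split (3 ∷ 2 ∷ []) (split (5 ∷ 7 ∷ 4 ∷ 1 ∷ []) (mono 6 17 0)
  (split (9 ∷ 13 ∷ 6 ∷ 1 ∷ []) (mono 18 0 11) (split (11 ∷ 17 ∷ 8 ∷ 1 ∷ [])
  (split (9 ∷ 14 ∷ 7 ∷ 1 ∷ []) (mono 20 0 1) (split (4 ∷ 2 ∷ []) (split (7 ∷ 10 ∷ 5 ∷ 1 ∷ [])
  (mono 1 0 15) (split (7 ∷ 11 ∷ 6 ∷ 1 ∷ []) (mono 2 0 4) (split (2 ∷ []) (mono 0 0 3) (mono 0 1 6)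
  (split (2 ∷ 2 ∷ []) (split (2 ∷ 2 ∷ 1 ∷ []) (split (4 ∷ 5 ∷ 2 ∷ []) (mono 27 1 0) (mono 17 0 7)
  (split (8 ∷ 13 ∷ 7 ∷ 1 ∷ []) (mono 24 0 9) (split (3 ∷ 4 ∷ 2 ∷ []) (split (1 ∷ 2 ∷ [])
  (mono 0 30 1) (mono 0 8 2) (split (5 ∷ 6 ∷ 3 ∷ 1 ∷ []) (mono 5 15 0) (split (2 ∷ 3 ∷ [])
  (split (9 ∷ 12 ∷ 5 ∷ 1 ∷ []) (mono 1 0 14) (split (4 ∷ 5 ∷ 1 ∷ []) (mono 34 9 0) (mono 0 29 14)
  (split (5 ∷ 6 ∷ 1 ∷ []) (mono 31 10 0) (split (3 ∷ 3 ∷ []) (split (5 ∷ 9 ∷ 6 ∷ 1 ∷ [])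
  (mono 23 8 0) (split (6 ∷ 7 ∷ 1 ∷ []) (mono 34 2 0) (split (6 ∷ 6 ∷ 1 ∷ []) (mono 35 23 0)
  (split (12 ∷ 17 ∷ 7 ∷ 1 ∷ []) (split (10 ∷ 14 ∷ 6 ∷ 1 ∷ []) (mono 41 0 1) (mono 31 36 0)
  (split (4 ∷ 1 ∷ []) (split (7 ∷ 12 ∷ 7 ∷ 1 ∷ []) (mono 1 0 24) (split (1 ∷ 1 ∷ 1 ∷ [])
  (mono 44 0 15) (mono 38 0 1) (split (3 ∷ []) (split (9 ∷ 12 ∷ 4 ∷ []) (mono 32 0 27)
  (split (5 ∷ 3 ∷ 1 ∷ []) (mono 47 2 0) (split (10 ∷ 13 ∷ 5 ∷ 1 ∷ []) (mono 23 0 8) (mono 1 43 0)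
  (split (14 ∷ 20 ∷ 8 ∷ 1 ∷ []) (mono 45 42 0) (mono 2 3 0) (split (13 ∷ 19 ∷ 8 ∷ 1 ∷ [])
  (mono 50 43 0) (split (4 ∷ 3 ∷ []) (split (8 ∷ 8 ∷ 1 ∷ []) (mono 10 1 0) (mono 17 0 2)
  (split (7 ∷ 6 ∷ []) (mono 8 2 0) (mono 15 0 3) (mono 40 0 1))) (mono 0 34 31) (mono 0 3 2))
  (mono 48 0 1)))) (mono 0 3 38)) (mono 2 0 5)) (mono 0 8 37) (mono 0 1 44))) (mono 13 34 0))
  (mono 0 25 9) (mono 0 33 1))) (mono 34 1 0) (mono 16 37 0)) (mono 5 0 36)) (mono 14 4 0))
  (mono 3 35 0)) (mono 0 19 8) (mono 23 0 2)) (mono 33 1 0))) (mono 3 0 30)) (mono 0 1 9)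
  (mono 30 2 0)) (mono 1 0 22))) (mono 19 0 1) (mono 27 0 2)) (mono 27 1 0))) (mono 16 0 3)
  (mono 13 24 0)) (mono 0 8 2) (mono 23 12 0))) (mono 10 14 0)) (mono 20 13 0)) (mono 0 6 1)
  (mono 0 12 18)) (mono 18 0 17)) (mono 14 7 0) (mono 6 16 0)) (mono 5 0 15)) (mono 4 0 8))
  (mono 11 0 8) (mono 3 0 15)) (mono 14 13 0)) (mono 0 2 6) (mono 0 13 5))) (mono 11 0 9))
  (mono 1 0 3) (mono 9 0 10)) (mono 0 8 1))) (mono 7 7 0)) (mono 1 2 0) (mono 5 4 0)) (mono 0 5 3))
  (mono 3 4 0)) (split (6 ∷ 5 ∷ 1 ∷ []) (split (8 ∷ 12 ∷ 6 ∷ 1 ∷ []) (mono 1 6 0)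
  (split (5 ∷ 8 ∷ 5 ∷ 1 ∷ []) (split (11 ∷ 16 ∷ 7 ∷ 1 ∷ []) (split (5 ∷ 5 ∷ 1 ∷ []) (mono 4 0 1)
  (split (3 ∷ 4 ∷ 1 ∷ []) (mono 0 10 3) (mono 0 1 4) (split (7 ∷ 11 ∷ 6 ∷ 1 ∷ []) (mono 11 4 0)
  (split (4 ∷ 7 ∷ 5 ∷ 1 ∷ []) (split (2 ∷ 4 ∷ 1 ∷ []) (mono 0 13 1) (mono 0 4 2)
  (split (6 ∷ 10 ∷ 6 ∷ 1 ∷ []) (mono 14 2 0) (split (9 ∷ 14 ∷ 7 ∷ 1 ∷ []) (split (2 ∷ [])
  (mono 0 1 8) (mono 0 2 10) (split (3 ∷ 3 ∷ 1 ∷ []) (mono 12 0 2) (split (6 ∷ 7 ∷ 2 ∷ [])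
  (split (3 ∷ 2 ∷ []) (mono 0 0 1) (mono 10 0 13) (split (5 ∷ 4 ∷ 1 ∷ []) (mono 0 2 12)
  (mono 0 3 14) (split (7 ∷ 6 ∷ 1 ∷ []) (mono 0 21 6) (split (8 ∷ 11 ∷ 5 ∷ 1 ∷ [])
  (split (9 ∷ 13 ∷ 6 ∷ 1 ∷ []) (mono 23 0 15) (split (5 ∷ 6 ∷ 2 ∷ []) (split (3 ∷ 2 ∷ 1 ∷ [])
  (mono 0 1 3) (split (6 ∷ 4 ∷ 1 ∷ []) (mono 0 2 18) (mono 0 9 3) (split (4 ∷ 5 ∷ 2 ∷ [])
  (split (6 ∷ 8 ∷ 3 ∷ []) (mono 28 1 0) (mono 3 0 5) (split (12 ∷ 18 ∷ 8 ∷ 1 ∷ []) (mono 24 11 0)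
  (mono 8 20 0) (mono 3 1 0))) (mono 10 0 16) (mono 1 0 24))) (mono 9 0 5)) (mono 7 0 18)
  (mono 4 0 21)) (mono 3 22 0)) (mono 5 13 0) (mono 2 3 0)) (mono 5 1 0)))) (mono 14 1 0)
  (mono 17 0 15)) (mono 15 0 16))) (mono 11 1 0) (mono 13 0 12)) (mono 1 13 0))) (mono 8 0 1)
  (mono 2 10 0)) (mono 1 10 0))) (mono 7 8 0)) (mono 4 2 0) (mono 6 5 0)) (mono 3 0 1) (mono 6 5 0))
  (mono 5 5 0)) (mono 1 1 0) (mono 0 4 2)) (mono 0 2 3))))

upper-bound : ∀ a → 1 ≤ a → RadoProp 3 a (radoNumber a)
upper-bound (suc b) _ =
  subst₂ (RadoProp 3) (⟦c∷1⟧ 1 b) (trans (⟦radoNumberᴾ⟧ a b) (cong radoNumber (⟦c∷1⟧ 1 b)))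
    (valid⇒rado a+1 upperCertificate (from-yes (inRange? a+1))
      (from-yes (valid? ((a+1 , zero) ∷ []) upperCertificate)) b)
  where
  a a+1 : Poly
  a   = 1 ∷ 1 ∷ []
  a+1 = 2 ∷ 1 ∷ []
  open Refutation a (radoNumberᴾ a)

extremalColouring : Poly → List (Poly × Fin 3)
extremalColouring a =
    (a                                  , 0F)
  ∷ (a *ᴾ (a +ᴾ [ 2 ])                  , 1F)
  ∷ (a *ᴾ (a +ᴾ [ 3 ])                  , 0F)
  ∷ (a *ᴾ (a *ᴾ (a +ᴾ [ 4 ]) +ᴾ [ 4 ])  , 2F)
  ∷ (a *ᴾ (a *ᴾ (a +ᴾ [ 4 ]) +ᴾ [ 5 ])  , 0F)
  ∷ (a *ᴾ (a *ᴾ (a +ᴾ [ 5 ]) +ᴾ [ 6 ])  , 1F)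
  ∷ (a *ᴾ (a *ᴾ (a +ᴾ [ 5 ]) +ᴾ [ 7 ])  , 0F)
  ∷ []

sumFree⇒¬rado : ∀ a → SumFreeBlocks.SumFree a (extremalColouring a) →
                ∀ x m → m < radoNumber (⟦ a ⟧ x) → ¬ RadoProp 3 (⟦ a ⟧ x) m
sumFree⇒¬rado a sumFree x m m<R rado =
  SumFreeBlocks.sumFree⇒noMonoSol a (extremalColouring a) sumFree x m m≤top (rado _)
  where
  top : Poly
  top = lastTop [] (extremalColouring a)
  m≤top : m ≤ ⟦ top ⟧ x
  m≤top = ≤-pred (begin-strict
    m                            <⟨ m<R ⟩
    radoNumber (⟦ a ⟧ x)         ≡⟨ ⟦radoNumberᴾ⟧ a x ⟨
    ⟦ top +ᴾ [ 1 ] ⟧ x           ≡⟨ ⟦+ᴾ1⟧ top x ⟩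
    suc (⟦ top ⟧ x)              ∎)
    where open ≤-Reasoning

-- Some triples of blocks are apart in one way for a = 1 and in the other way for a ≥ 2, so no
-- coefficientwise check in a − 1 covers both; a = 1 and a = 2 + c are checked separately.
lower-bound : ∀ a → 1 ≤ a → ∀ m → m < radoNumber a → ¬ RadoProp 3 a m
lower-bound 1             _ = sumFree⇒¬rado [ 1 ] (from-yes (sumFree? (extremalColouring [ 1 ]))) 0
  where open SumFreeBlocks [ 1 ]
lower-bound (suc (suc c)) _ =
  subst (λ a → ∀ m → m < radoNumber a → ¬ RadoProp 3 a m) (⟦c∷1⟧ 2 c)
    (sumFree⇒¬rado a (from-yes (sumFree? (extremalColouring a))) c)
  where
  a : Poly
  a = 2 ∷ 1 ∷ []
  open SumFreeBlocks a

proposition1 : (a : ℕ) → 1 ≤ a →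
    IsRadoNumber 3 a (a ^ 3 + 5 * a ^ 2 + 7 * a + 1)
proposition1 a 1≤a = m≤n+m 1 _ , upper-bound a 1≤a , λ m _ → lower-bound a 1≤a m
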